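{- Let $m\geq1$ be an integer and $\mathcal{M}$ a matroid. (a) If $\mathcal{M}$ satisfies $(1+1/k)$-Ray$[k]$ for all $1\leq k\leq m$, then $\mathcal{M}$ satisfies $\sqrt{\mathrm{BLC}}[2m+1]$. (b) If $\mathcal{M}$ satisfies $1$-Ray$[k]$ for all $1\leq k\leq m$, then $\mathcal{M}$ satisfies SLC$[2m+1]$.
   Context: Let $\mathcal{M}$ be a matroid on a finite ground set $E$, identified with its set of bases. Write $\mathbf{y}>\mathbf{0}$ for an assignment of positive real weights $\mathbf{y}=(y_e)_{e\in E}$, and $\mathbf{y}^A=\prod_{e\in A}y_e$. For disjoint $I,J\subseteq E$ let $M_I^J(\mathbf{y})=\sum \mathbf{y}^{B\setminus I}$, the sum over all bases $B$ of $\mathcal{M}$ with $I\subseteq B\subseteq E\setminus J$. For $S\subseteq E$ and an integer $j$ let $M_j(S,\mathbf{y})=\sum\mathbf{y}^B$, over all bases $B$ with $|B\cap S|=j$. For $S\subseteq E$ and integer $k$ let $\Psi_k M S(\mathbf{y})=\sum_{A\subseteq S,\ |A|=k} M_A^{S\setminus A}(\mathbf{y})\,M_{S\setminus A}^{A}(\mathbf{y})$. $\lambda$-Ray$[k]$ (for integer $k\ge1$, real $\lambda>0$): for all $\mathbf{y}>\mathbf{0}$ and all $S\subseteq E$ with $|S|=2k$, $\Psi_kMS(\mathbf{y})\geq\lambda\,\Psi_{k+1}MS(\mathbf{y})$. $\sqrt{\mathrm{BLC}}[m]$: for all $\mathbf{y}>\mathbf{0}$, all $S\subseteq E$ with $|S|=n\leq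 m$ and all $1\leq j\leq n-1$, if $M_j(S,\mathbf{y})\neq 0$ then $M_j(S,\mathbf{y})^2>\bigl[1+\frac{1}{\min(j,n-j)}\bigr]M_{j-1}(S,\mathbf{y})M_{j+1}(S,\mathbf{y})$. SLC$[m]$: for all $\mathbf{y}>\mathbf{0}$, all $S\subseteq E$ with $|S|\leq m$ and all $1\leq j\leq |S|-1$, if $M_j(S,\mathbf{y})\neq0$ then $M_j(S,\mathbf{y})^2>M_{j-1}(S,\mathbf{y})M_{j+1}(S,\mathbf{y})$. -}

module Defs where

open import Data.Bool using (Bool; true; false; _∧_; not)
open import Data.Nat using (ℕ; zero; suc; _∸_; _≡ᵇ_) renaming (_+_ to _+ℕ_; _≤_ to _≤ℕ_)
open import Data.Nat using (_⊓_)
open import Data.Fin using (Fin; zero; suc)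
open import Data.Fin.Subset using (Subset; inside; outside; _∈_; _∉_; _∩_; _─_; ∣_∣)
open import Data.Vec using (Vec; []; _∷_; _[_]≔_)
open import Data.List using (List; []; _∷_; _++_; map; foldr; filter)
open import Data.Product using (_×_; ∃; Σ)
open import Data.Sum using (_⊎_)
open import Relation.Binary.PropositionalEquality using (_≡_)
open import Relation.Nullary using (¬_)
open import Function using (_∘_)

-- The real numbers, axiomatised as a (Dedekind-)complete ordered field.
-- (Any two such fields are isomorphic, so quantifying over all of them
-- is the same as speaking about ℝ.)  The inverse is total; only
-- x * inv x ≡ 1 for x ≢ 0 is required.

record CompleteOrderedField : Set₁ where
  infixl 6 _+_
  infixl 7 _*_
  infix 4 _<_ _≤_
  field
    R : Set
    0# 1# : R
    _+_ _*_ : R → R → R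
    -_ inv : R → R
    _<_ : R → R → Set
    +-assoc : ∀ x y z → (x + y) + z ≡ x + (y + z)
    +-comm : ∀ x y → x + y ≡ y + x
    +-identityˡ : ∀ x → 0# + x ≡ x
    -‿inverseˡ : ∀ x → (- x) + x ≡ 0#
    *-assoc : ∀ x y z → (x * y) * z ≡ x * (y * z)
    *-comm : ∀ x y → x * y ≡ y * x
    *-identityˡ : ∀ x → 1# * x ≡ x
    distribˡ : ∀ x y z → x * (y + z) ≡ x * y + x * z
    0≢1 : ¬ (0# ≡ 1#)
    inv-inverse : ∀ x → ¬ (x ≡ 0#) → x * inv x ≡ 1#
    <-irrefl : ∀ x → ¬ (x < x)
    <-trans : ∀ x y z → x < y → y < z → x < z
    <-trichotomy : ∀ x y → (x < y) ⊎ ((x ≡ y) ⊎ (y < x))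
    +-mono-< : ∀ x y z → x < y → x + z < y + z
    *-pos : ∀ x y → 0# < x → 0# < y → 0# < x * y
  _≤_ : R → R → Set
  x ≤ y = (x < y) ⊎ (x ≡ y)
  field
    complete : (P : R → Set) → ∃ P → ∃ (λ b → ∀ x → P x → x ≤ b) →
               ∃ (λ s → (∀ x → P x → x ≤ s) × (∀ b → (∀ x → P x → x ≤ b) → s ≤ b))

record Matroid (n : ℕ) : Set where
  field
    isBasis : Subset n → Bool
    nonempty : ∃ λ B → isBasis B ≡ true
    exchange : ∀ B₁ B₂ → isBasis B₁ ≡ true → isBasis B₂ ≡ true →
               ∀ x → x ∈ B₁ → x ∉ B₂ →
               ∃ λ y → (y ∈ B₂) × (y ∉ B₁) ×
                 (isBasis ((B₁ [ x ]≔ outside) [ y ]≔ inside) ≡ true)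
open Matroid public

subsets : (n : ℕ) → List (Subset n)
subsets zero = [] ∷ []
subsets (suc n) = map (outside ∷_) (subsets n) ++ map (inside ∷_) (subsets n)

_⊆ᵇ_ : ∀ {n} → Subset n → Subset n → Bool
[] ⊆ᵇ [] = true
(true ∷ p) ⊆ᵇ (false ∷ q) = false
(_ ∷ p) ⊆ᵇ (_ ∷ q) = p ⊆ᵇ q

disjᵇ : ∀ {n} → Subset n → Subset n → Bool
disjᵇ [] [] = true
disjᵇ (true ∷ p) (true ∷ q) = false
disjᵇ (_ ∷ p) (_ ∷ q) = disjᵇ p q

module Theory (F : CompleteOrderedField) where
  open CompleteOrderedField F

  fromℕ : ℕ → R
  fromℕ zero = 0#
  fromℕ (suc k) = 1# + fromℕ k

  sumR : List R → R
  sumR = foldr _+_ 0#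

  Weights : ℕ → Set
  Weights n = Fin n → R

  Positive : ∀ {n} → Weights n → Set
  Positive y = ∀ i → 0# < y i

  mono : ∀ {n} → Weights n → Subset n → R
  mono y [] = 1#
  mono y (true ∷ A) = y zero * mono (y ∘ suc) A
  mono y (false ∷ A) = mono (y ∘ suc) A

  bases : ∀ {n} → Matroid n → List (Subset n)
  bases M = filter' (isBasis M) (subsets _)
    where
    filter' : ∀ {A : Set} → (A → Bool) → List A → List A
    filter' p [] = []
    filter' p (x ∷ xs) with p x
    ... | true = x ∷ filter' p xs
    ... | false = filter' p xs

  selectSum : ∀ {n} → (Subset n → Bool) → (Subset n → R) → List (Subset n) → R
  selectSum p f [] = 0#
  selectSum p f (x ∷ xs) with p x
  ... | true = f x + selectSum p f xs
  ... | false = selectSum p f xs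

  MIJ : ∀ {n} → Matroid n → Subset n → Subset n → Weights n → R
  MIJ M I J y = selectSum (λ B → (I ⊆ᵇ B) ∧ disjᵇ B J) (λ B → mono y (B ─ I)) (bases M)

  Mj : ∀ {n} → Matroid n → ℕ → Subset n → Weights n → R
  Mj M j S y = selectSum (λ B → ∣ B ∩ S ∣ ≡ᵇ j) (mono y) (bases M)

  Ψ : ∀ {n} → Matroid n → ℕ → Subset n → Weights n → R
  Ψ M k S y = selectSum (λ A → (A ⊆ᵇ S) ∧ (∣ A ∣ ≡ᵇ k))
                (λ A → MIJ M A (S ─ A) y * MIJ M (S ─ A) A y) (subsets _)

  Ray : ∀ {n} → Matroid n → ℕ → R → Set
  Ray {n} M k λ' = (y : Weights n) → Positive y → (S : Subset n) → ∣ S ∣ ≡ k +ℕ k →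
                   λ' * Ψ M (suc k) S y ≤ Ψ M k S y

  SqrtBLC : ∀ {n} → Matroid n → ℕ → Set
  SqrtBLC {n} M m = (y : Weights n) → Positive y → (S : Subset n) → ∣ S ∣ ≤ℕ m →
    (j : ℕ) → 1 ≤ℕ j → j ≤ℕ ∣ S ∣ ∸ 1 → ¬ (Mj M j S y ≡ 0#) →
    (1# + inv (fromℕ (j ⊓ (∣ S ∣ ∸ j)))) * (Mj M (j ∸ 1) S y * Mj M (suc j) S y)
      < Mj M j S y * Mj M j S y

  SLC : ∀ {n} → Matroid n → ℕ → Set
  SLC {n} M m = (y : Weights n) → Positive y → (S : Subset n) → ∣ S ∣ ≤ℕ m →
    (j : ℕ) → 1 ≤ℕ j → j ≤ℕ ∣ S ∣ ∸ 1 → ¬ (Mj M j S y ≡ 0#) →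
    Mj M (j ∸ 1) S y * Mj M (suc j) S y < Mj M j S y * Mj M j S y

{-# OPTIONS --safe #-}
module Submission where

-- Expand M_{j-1}·M_{j+1} and M_j² as sums over pairs (B₁, B₂) of bases and
-- sort the pairs by how they meet S: each element of S lies in both bases
-- (the set I), in neither (J), or in exactly one (the rest, T).  For fixed I
-- and J, and after dividing out y^{2I}, the pairs counted by M_{j-1}·M_{j+1}
-- resp. M_j² add up to y^T·Ψ_{k+1} resp. y^T·Ψ_k of the minor M/I∖J on T,
-- where 2k = |T| ≤ |S| ≤ 2m+1 and k ≤ min(j, |S|-j).  Ray[k] passes from M
-- to these minors, so summing over (I, J) gives λ·M_{j-1}·M_{j+1} ≤ M_j²,
-- with λ = 1 + 1/k ≥ 1 + 1/min(j, |S|-j) resp. λ = 1.  The inequality is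
-- strict because a pair (B, B) with |B ∩ S| = j contributes to M_j² only.

open import Defs
open import Data.Nat using (ℕ)

module OrderedFieldProperties (F : CompleteOrderedField) where
  open CompleteOrderedField F
  open import Algebra.Bundles using (CommutativeRing)
  import Algebra.Properties.Ring as RingProperties
  import Algebra.Properties.CommutativeSemigroup as CommutativeSemigroupProperties
  open import Data.Empty using (⊥-elim)
  open import Data.Nat using (zero; suc; z≤n; s≤s) renaming (_≤_ to _≤ℕ_)
  open import Data.Product using (_,_; ∃; _×_; proj₁; proj₂)
  open import Data.Sum using (inj₁; inj₂)
  import Data.Sum as Sum
  open import Relation.Nullary using (¬_)
  open import Relation.Binary.PropositionalEquality
  import Relation.Binary.Construct.StrictToNonStrict _≡_ _<_ as NonStrict
  open import Tactic.RingSolver.Core.AlmostCommutativeRing using (AlmostCommutativeRing; fromCommutativeRing)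
  open import Data.Maybe using (nothing)
  open ≡-Reasoning

  ring : CommutativeRing _ _
  ring = record
    { Carrier = R ; _≈_ = _≡_ ; _+_ = _+_ ; _*_ = _*_ ; -_ = -_ ; 0# = 0# ; 1# = 1#
    ; isCommutativeRing = record
      { isRing = record
        { +-isAbelianGroup = record
          { isGroup = record
            { isMonoid = record
              { isSemigroup = record
                { isMagma = record { isEquivalence = isEquivalence ; ∙-cong = cong₂ _+_ }
                ; assoc = +-assoc }
              ; identity = +-identityˡ , λ x → trans (+-comm x 0#) (+-identityˡ x) }
            ; inverse = -‿inverseˡ , λ x → trans (+-comm x (- x)) (-‿inverseˡ x)
            ; ⁻¹-cong = cong -_ }
          ; comm = +-comm }
        ; *-cong = cong₂ _*_
        ; *-assoc = *-assoc
        ; *-identity = *-identityˡ , λ x → trans (*-comm x 1#) (*-identityˡ x)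
        ; distrib = distribˡ , λ x y z → trans (*-comm (y + z) x)
                                  (trans (distribˡ x y z) (cong₂ _+_ (*-comm x y) (*-comm x z))) }
      ; *-comm = *-comm } }

  open CommutativeRing ring public
    using (_-_; +-identityʳ; *-identityʳ; -‿inverseʳ; distribʳ; zeroˡ; zeroʳ)
  open RingProperties (CommutativeRing.ring ring) public
    using (-‿involutive; -1*x≈-x; x[y-z]≈xy-xz; +-inverseˡ-unique)
  open CommutativeSemigroupProperties (CommutativeRing.*-commutativeSemigroup ring) public
    using () renaming (xy∙z≈y∙xz to *-xy∙z≈y∙xz; x∙yz≈y∙xz to *-x∙yz≈y∙xz; interchange to *-interchange)

  almostCommutativeRing : AlmostCommutativeRing _ _
  almostCommutativeRing = fromCommutativeRing ring (λ _ → nothing)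

  ≤-refl : ∀ {x} → x ≤ x
  ≤-refl = NonStrict.reflexive refl

  ≤-trans : ∀ {x y z} → x ≤ y → y ≤ z → x ≤ z
  ≤-trans = NonStrict.trans isEquivalence (resp₂ _<_) (<-trans _ _ _)

  <-≤-trans : ∀ {x y z} → x < y → y ≤ z → x < z
  <-≤-trans = NonStrict.<-≤-trans (<-trans _ _ _) (proj₁ (resp₂ _<_))

  ≤-<-trans : ∀ {x y z} → x ≤ y → y < z → x < z
  ≤-<-trans = NonStrict.≤-<-trans sym (<-trans _ _ _) (proj₂ (resp₂ _<_))

  <⇒≱ : ∀ {x y} → x < y → ¬ (y ≤ x)
  <⇒≱ x<y y≤x = <-irrefl _ (<-≤-trans x<y y≤x)

  +-monoˡ-< : ∀ z {x y} → x < y → x + z < y + z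
  +-monoˡ-< z = +-mono-< _ _ z

  +-monoʳ-< : ∀ z {x y} → x < y → z + x < z + y
  +-monoʳ-< z {x} {y} x<y = subst₂ _<_ (+-comm x z) (+-comm y z) (+-monoˡ-< z x<y)

  +-monoˡ-≤ : ∀ z {x y} → x ≤ y → x + z ≤ y + z
  +-monoˡ-≤ z = Sum.map (+-monoˡ-< z) (cong (_+ z))

  +-monoʳ-≤ : ∀ z {x y} → x ≤ y → z + x ≤ z + y
  +-monoʳ-≤ z = Sum.map (+-monoʳ-< z) (cong (z +_))

  +-mono-≤ : ∀ {a b c d} → a ≤ b → c ≤ d → a + c ≤ b + d
  +-mono-≤ a≤b c≤d = ≤-trans (+-monoˡ-≤ _ a≤b) (+-monoʳ-≤ _ c≤d)

  +-mono-<-≤ : ∀ {a b c d} → a < b → c ≤ d → a + c < b + d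
  +-mono-<-≤ a<b c≤d = <-≤-trans (+-monoˡ-< _ a<b) (+-monoʳ-≤ _ c≤d)

  +-mono-≤-< : ∀ {a b c d} → a ≤ b → c < d → a + c < b + d
  +-mono-≤-< a≤b c<d = ≤-<-trans (+-monoˡ-≤ _ a≤b) (+-monoʳ-< _ c<d)

  x<x+y : ∀ x {y} → 0# < y → x < x + y
  x<x+y x 0<y = subst (_< x + _) (+-identityʳ x) (+-monoʳ-< x 0<y)

  x≤x+y : ∀ x {y} → 0# ≤ y → x ≤ x + y
  x≤x+y x 0≤y = subst (_≤ x + _) (+-identityʳ x) (+-monoʳ-≤ x 0≤y)

  +-nonNeg : ∀ {x y} → 0# ≤ x → 0# ≤ y → 0# ≤ x + y
  +-nonNeg 0≤x 0≤y = ≤-trans 0≤x (x≤x+y _ 0≤y)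

  +-pos-nonNeg : ∀ {x y} → 0# < x → 0# ≤ y → 0# < x + y
  +-pos-nonNeg 0<x 0≤y = <-≤-trans 0<x (x≤x+y _ 0≤y)

  x<y⇒0<y-x : ∀ {x y} → x < y → 0# < y - x
  x<y⇒0<y-x {x} {y} x<y = subst (_< y - x) (-‿inverseʳ x) (+-monoˡ-< (- x) x<y)

  y-x+x≡y : ∀ x y → y - x + x ≡ y
  y-x+x≡y x y = trans (+-assoc y (- x) x) (trans (cong (y +_) (-‿inverseˡ x)) (+-identityʳ y))

  0<y-x⇒x<y : ∀ {x y} → 0# < y - x → x < y
  0<y-x⇒x<y {x} {y} 0<y-x = subst₂ _<_ (+-identityˡ x) (y-x+x≡y x y) (+-monoˡ-< x 0<y-x)

  x≤y⇒0≤y-x : ∀ {x y} → x ≤ y → 0# ≤ y - x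
  x≤y⇒0≤y-x {x} = Sum.map x<y⇒0<y-x (λ x≡y → trans (sym (-‿inverseʳ x)) (cong (_- x) x≡y))

  0≤y-x⇒x≤y : ∀ {x y} → 0# ≤ y - x → x ≤ y
  0≤y-x⇒x≤y {x} {y} = Sum.map 0<y-x⇒x<y
    (λ 0≡y-x → trans (sym (+-identityˡ x)) (trans (cong (_+ x) 0≡y-x) (y-x+x≡y x y)))

  *-monoʳ-<-pos : ∀ {c} → 0# < c → ∀ {a b} → a < b → c * a < c * b
  *-monoʳ-<-pos {c} 0<c {a} {b} a<b =
    0<y-x⇒x<y (subst (0# <_) (x[y-z]≈xy-xz c b a) (*-pos c (b - a) 0<c (x<y⇒0<y-x a<b)))

  *-monoʳ-≤-nonNeg : ∀ {c} → 0# ≤ c → ∀ {a b} → a ≤ b → c * a ≤ c * b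
  *-monoʳ-≤-nonNeg (inj₁ 0<c) = Sum.map (*-monoʳ-<-pos 0<c) (cong (_ *_))
  *-monoʳ-≤-nonNeg (inj₂ refl) {a} {b} _ = inj₂ (trans (zeroˡ a) (sym (zeroˡ b)))

  *-monoˡ-≤-nonNeg : ∀ {c} → 0# ≤ c → ∀ {a b} → a ≤ b → a * c ≤ b * c
  *-monoˡ-≤-nonNeg {c} 0≤c {a} {b} a≤b = subst₂ _≤_ (*-comm c a) (*-comm c b) (*-monoʳ-≤-nonNeg 0≤c a≤b)

  0<1 : 0# < 1#
  0<1 with <-trichotomy 0# 1#
  ... | inj₁ 0<1 = 0<1
  ... | inj₂ (inj₁ 0≡1) = ⊥-elim (0≢1 0≡1)
  ... | inj₂ (inj₂ 1<0) = ⊥-elim (<-irrefl 1# (<-trans _ _ _ 1<0 0<[-1][-1]))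
    where
    0<-1 : 0# < - 1#
    0<-1 = subst (0# <_) (+-identityˡ (- 1#)) (x<y⇒0<y-x 1<0)
    0<[-1][-1] : 0# < 1#
    0<[-1][-1] = subst (0# <_) (trans (-1*x≈-x (- 1#)) (-‿involutive 1#)) (*-pos _ _ 0<-1 0<-1)

  pos⇒≢0 : ∀ {x} → 0# < x → ¬ (x ≡ 0#)
  pos⇒≢0 0<x refl = <-irrefl 0# 0<x

  *-inverseʳ-pos : ∀ {x} → 0# < x → x * inv x ≡ 1#
  *-inverseʳ-pos {x} 0<x = inv-inverse x (pos⇒≢0 0<x)

  inv-pos : ∀ {x} → 0# < x → 0# < inv x
  inv-pos {x} 0<x with <-trichotomy 0# (inv x)
  ... | inj₁ 0<x⁻¹ = 0<x⁻¹
  ... | inj₂ (inj₁ 0≡x⁻¹) = ⊥-elim (0≢1 (begin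
    0#          ≡⟨ sym (zeroʳ x) ⟩
    x * 0#      ≡⟨ cong (x *_) 0≡x⁻¹ ⟩
    x * inv x   ≡⟨ *-inverseʳ-pos 0<x ⟩
    1#          ∎))
  ... | inj₂ (inj₂ x⁻¹<0) = ⊥-elim (<⇒≱ 0<1 (inj₁ 1<0))
    where
    1<0 : 1# < 0#
    1<0 = subst₂ _<_ (*-inverseʳ-pos 0<x) (zeroʳ x) (*-monoʳ-<-pos 0<x x⁻¹<0)

  inv-antitone : ∀ {a b} → 0# < a → a ≤ b → inv b ≤ inv a
  inv-antitone 0<a (inj₂ refl) = ≤-refl
  inv-antitone {a} {b} 0<a (inj₁ a<b) = inj₁ (subst₂ _<_ a⁻¹b⁻¹a≡b⁻¹ a⁻¹b⁻¹b≡a⁻¹ a⁻¹b⁻¹a<a⁻¹b⁻¹b)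
    where
    0<b = <-trans _ _ _ 0<a a<b
    a⁻¹b⁻¹a<a⁻¹b⁻¹b : inv a * inv b * a < inv a * inv b * b
    a⁻¹b⁻¹a<a⁻¹b⁻¹b = *-monoʳ-<-pos (*-pos _ _ (inv-pos 0<a) (inv-pos 0<b)) a<b
    a⁻¹b⁻¹a≡b⁻¹ : inv a * inv b * a ≡ inv b
    a⁻¹b⁻¹a≡b⁻¹ = begin
      inv a * inv b * a    ≡⟨ *-xy∙z≈y∙xz (inv a) (inv b) a ⟩
      inv b * (inv a * a)  ≡⟨ cong (inv b *_) (trans (*-comm (inv a) a) (*-inverseʳ-pos 0<a)) ⟩
      inv b * 1#           ≡⟨ *-identityʳ (inv b) ⟩
      inv b                ∎
    a⁻¹b⁻¹b≡a⁻¹ : inv a * inv b * b ≡ inv a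
    a⁻¹b⁻¹b≡a⁻¹ = begin
      inv a * inv b * b    ≡⟨ *-assoc (inv a) (inv b) b ⟩
      inv a * (inv b * b)  ≡⟨ cong (inv a *_) (trans (*-comm (inv b) b) (*-inverseʳ-pos 0<b)) ⟩
      inv a * 1#           ≡⟨ *-identityʳ (inv a) ⟩
      inv a                ∎

  open Theory F using (fromℕ)

  fromℕ-nonNeg : ∀ k → 0# ≤ fromℕ k
  fromℕ-nonNeg zero    = ≤-refl
  fromℕ-nonNeg (suc k) = +-nonNeg (inj₁ 0<1) (fromℕ-nonNeg k)

  fromℕ-pos : ∀ k → 0# < fromℕ (suc k)
  fromℕ-pos k = +-pos-nonNeg 0<1 (fromℕ-nonNeg k)

  fromℕ-mono : ∀ {k l} → k ≤ℕ l → fromℕ k ≤ fromℕ l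
  fromℕ-mono {l = l} z≤n = fromℕ-nonNeg l
  fromℕ-mono (s≤s k≤l)   = +-monoʳ-≤ 1# (fromℕ-mono k≤l)

  nonNeg-upper-bound : ∀ x → ∃ λ u → 0# ≤ u × x ≤ u
  nonNeg-upper-bound x with <-trichotomy 0# x
  ... | inj₁ 0<x = x , inj₁ 0<x , ≤-refl
  ... | inj₂ (inj₁ 0≡x) = 0# , ≤-refl , inj₂ (sym 0≡x)
  ... | inj₂ (inj₂ x<0) = 0# , ≤-refl , inj₁ x<0

module Quadratics (F : CompleteOrderedField) where
  open CompleteOrderedField F
  open OrderedFieldProperties F
  open import Tactic.RingSolver.NonReflective almostCommutativeRing using (solve; _⊜_; _⊕_; _⊗_)
  open import Data.Empty using (⊥-elim)
  open import Data.Product using (_,_; ∃; _×_)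
  open import Data.Sum using (inj₁; inj₂)
  open import Relation.Binary.PropositionalEquality
  open ≡-Reasoning

  quad : R → R → R → R → R
  quad t a b c = t * (t * a) + t * b + c

  quad-small : ∀ a b {e} → 0# < e → ∃ λ t → 0# < t × t * (t * a) + t * b < e
  quad-small a b {e} 0<e with nonNeg-upper-bound a | nonNeg-upper-bound b
  ... | uᵃ , 0≤uᵃ , a≤uᵃ | uᵇ , 0≤uᵇ , b≤uᵇ =
    t , 0<t , ≤-<-trans bound (<-trans _ _ _ (*-monoʳ-<-pos 0<t (x<x+y u 0<1)) tP<e)
    where
    u = uᵃ + uᵇ
    P = u + 1#
    D = P + e
    0<P : 0# < P
    0<P = ≤-<-trans (+-nonNeg 0≤uᵃ 0≤uᵇ) (x<x+y u 0<1)
    0<D : 0# < D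
    0<D = <-trans _ _ _ 0<P (x<x+y P 0<e)
    D⁻¹D≡1 : inv D * D ≡ 1#
    D⁻¹D≡1 = trans (*-comm (inv D) D) (*-inverseʳ-pos 0<D)
    t = e * inv D
    0<t : 0# < t
    0<t = *-pos _ _ 0<e (inv-pos 0<D)
    tD≡e : t * D ≡ e
    tD≡e = trans (*-assoc e (inv D) D) (trans (cong (e *_) D⁻¹D≡1) (*-identityʳ e))
    t≤1 : t ≤ 1#
    t≤1 = inj₁ (subst₂ _<_ (*-comm (inv D) e) D⁻¹D≡1
            (*-monoʳ-<-pos (inv-pos 0<D) (subst (_< D) (+-identityˡ e) (+-monoˡ-< e 0<P))))
    ta≤uᵃ : t * a ≤ uᵃ
    ta≤uᵃ = ≤-trans (*-monoʳ-≤-nonNeg (inj₁ 0<t) a≤uᵃ)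
              (subst (t * uᵃ ≤_) (*-identityˡ uᵃ) (*-monoˡ-≤-nonNeg 0≤uᵃ t≤1))
    bound : t * (t * a) + t * b ≤ t * u
    bound = subst (t * (t * a) + t * b ≤_) (sym (distribˡ t uᵃ uᵇ))
              (+-mono-≤ (*-monoʳ-≤-nonNeg (inj₁ 0<t) ta≤uᵃ) (*-monoʳ-≤-nonNeg (inj₁ 0<t) b≤uᵇ))
    tP<e : t * P < e
    tP<e = subst (t * P <_) (trans (sym (distribˡ t P e)) tD≡e) (x<x+y (t * P) (*-pos t e 0<t 0<e))

  quad-constant-nonNeg : ∀ a b c → (∀ t → 0# < t → 0# ≤ quad t a b c) → 0# ≤ c
  quad-constant-nonNeg a b c nonNeg with <-trichotomy 0# c
  ... | inj₁ 0<c = inj₁ 0<c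
  ... | inj₂ (inj₁ 0≡c) = inj₂ 0≡c
  ... | inj₂ (inj₂ c<0) with quad-small a b (subst (0# <_) (+-identityˡ (- c)) (x<y⇒0<y-x c<0))
  ...   | t , 0<t , small =
    ⊥-elim (<⇒≱ (subst (quad t a b c <_) (-‿inverseˡ c) (+-monoˡ-< c small)) (nonNeg t 0<t))

  quad-additive : ∀ t a b c a′ b′ c′ → quad t a b c + quad t a′ b′ c′ ≡ quad t (a + a′) (b + b′) (c + c′)
  quad-additive = solve 7 (λ t a b c a′ b′ c′ →
    ((t ⊗ (t ⊗ a) ⊕ t ⊗ b ⊕ c) ⊕ (t ⊗ (t ⊗ a′) ⊕ t ⊗ b′ ⊕ c′))
      ⊜ (t ⊗ (t ⊗ (a ⊕ a′)) ⊕ t ⊗ (b ⊕ b′) ⊕ (c ⊕ c′))) refl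

  quad-zero : ∀ t → quad t 0# 0# 0# ≡ 0#
  quad-zero t = begin
    t * (t * 0#) + t * 0# + 0#  ≡⟨ cong (λ x → t * x + t * 0# + 0#) (zeroʳ t) ⟩
    t * 0# + t * 0# + 0#        ≡⟨ cong (λ x → x + x + 0#) (zeroʳ t) ⟩
    0# + 0# + 0#                ≡⟨ trans (+-identityʳ _) (+-identityˡ 0#) ⟩
    0#                          ∎

  quad-leading-only : ∀ t a → quad t a 0# 0# ≡ t * (t * a)
  quad-leading-only t a = trans (+-identityʳ _) (trans (cong (t * (t * a) +_) (zeroʳ t)) (+-identityʳ _))

  quad-middle-only : ∀ t b → quad t 0# b 0# ≡ t * b
  quad-middle-only t b = trans (+-identityʳ _) (trans (cong (λ x → t * x + t * b) (zeroʳ t))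
                           (trans (cong (_+ t * b) (zeroʳ t)) (+-identityˡ _)))

  quad-constant-only : ∀ t c → quad t 0# 0# c ≡ c
  quad-constant-only t c = trans (cong (_+ c) (trans (cong (λ x → t * x + t * 0#) (zeroʳ t))
                             (trans (cong (λ x → x + x) (zeroʳ t)) (+-identityʳ 0#)))) (+-identityˡ c)

  quad-negate : ∀ t a b c → quad t (- a) (- b) (- c) ≡ - quad t a b c
  quad-negate t a b c = +-inverseˡ-unique _ _ (begin
    quad t (- a) (- b) (- c) + quad t a b c  ≡⟨ quad-additive t (- a) (- b) (- c) a b c ⟩
    quad t (- a + a) (- b + b) (- c + c)     ≡⟨ cong₂ (λ x y → quad t x y (- c + c)) (-‿inverseˡ a) (-‿inverseˡ b) ⟩
    quad t 0# 0# (- c + c)                   ≡⟨ cong (quad t 0# 0#) (-‿inverseˡ c) ⟩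
    quad t 0# 0# 0#                          ≡⟨ quad-zero t ⟩
    0#                                       ∎)

  quad-difference : ∀ t a₁ b₁ c₁ a₂ b₂ c₂ →
                    quad t a₂ b₂ c₂ - quad t a₁ b₁ c₁ ≡ quad t (a₂ - a₁) (b₂ - b₁) (c₂ - c₁)
  quad-difference t a₁ b₁ c₁ a₂ b₂ c₂ = begin
    quad t a₂ b₂ c₂ + - quad t a₁ b₁ c₁           ≡⟨ cong (quad t a₂ b₂ c₂ +_) (sym (quad-negate t a₁ b₁ c₁)) ⟩
    quad t a₂ b₂ c₂ + quad t (- a₁) (- b₁) (- c₁)  ≡⟨ quad-additive t a₂ b₂ c₂ (- a₁) (- b₁) (- c₁) ⟩
    quad t (a₂ - a₁) (b₂ - b₁) (c₂ - c₁)           ∎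

  quad-constant-≤ : ∀ {a₁ b₁ c₁ a₂ b₂ c₂} →
                    (∀ t → 0# < t → quad t a₁ b₁ c₁ ≤ quad t a₂ b₂ c₂) → c₁ ≤ c₂
  quad-constant-≤ {a₁} {b₁} {c₁} {a₂} {b₂} {c₂} ≤-everywhere =
    0≤y-x⇒x≤y (quad-constant-nonNeg (a₂ - a₁) (b₂ - b₁) (c₂ - c₁) λ t 0<t →
      subst (0# ≤_) (quad-difference t a₁ b₁ c₁ a₂ b₂ c₂) (x≤y⇒0≤y-x (≤-everywhere t 0<t)))

  quad-scale : ∀ x t a b c → x * quad t a b c ≡ quad t (x * a) (x * b) (x * c)
  quad-scale = solve 5 (λ x t a b c →
    (x ⊗ (t ⊗ (t ⊗ a) ⊕ t ⊗ b ⊕ c)) ⊜ (t ⊗ (t ⊗ (x ⊗ a)) ⊕ t ⊗ (x ⊗ b) ⊕ x ⊗ c)) refl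

  quad-reversal : ∀ {s} a b c → 0# < s → s * (s * quad (inv s) a b c) ≡ quad s c b a
  quad-reversal {s} a b c 0<s = begin
    s * (s * quad s⁻¹ a b c)
      ≡⟨ trans (cong (s *_) (quad-scale s s⁻¹ a b c)) (quad-scale s s⁻¹ (s * a) (s * b) (s * c)) ⟩
    s⁻¹ * (s⁻¹ * (s * (s * a))) + s⁻¹ * (s * (s * b)) + s * (s * c)
      ≡⟨ cong₂ (λ x y → x + y + s * (s * c)) (cancel² a) (cancel (s * b)) ⟩
    a + s * b + s * (s * c)
      ≡⟨ solve 4 (λ s a b c → (a ⊕ s ⊗ b ⊕ s ⊗ (s ⊗ c)) ⊜ (s ⊗ (s ⊗ c) ⊕ s ⊗ b ⊕ a)) refl s a b c ⟩
    quad s c b a ∎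
    where
    s⁻¹ = inv s
    cancel : ∀ x → s⁻¹ * (s * x) ≡ x
    cancel x = trans (sym (*-assoc s⁻¹ s x))
                 (trans (cong (_* x) (trans (*-comm s⁻¹ s) (*-inverseʳ-pos 0<s))) (*-identityˡ x))
    cancel² : ∀ x → s⁻¹ * (s⁻¹ * (s * (s * x))) ≡ x
    cancel² x = trans (cong (s⁻¹ *_) (trans (*-x∙yz≈y∙xz s⁻¹ s (s * x)) (cong (s *_) (cancel x)))) (cancel x)

  quad-leading-≤ : ∀ {a₁ b₁ c₁ a₂ b₂ c₂} →
                   (∀ t → 0# < t → quad t a₁ b₁ c₁ ≤ quad t a₂ b₂ c₂) → a₁ ≤ a₂
  quad-leading-≤ {a₁} {b₁} {c₁} {a₂} {b₂} {c₂} ≤-everywhere = quad-constant-≤ λ s 0<s →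
    subst₂ _≤_ (quad-reversal a₁ b₁ c₁ 0<s) (quad-reversal a₂ b₂ c₂ 0<s)
      (*-monoʳ-≤-nonNeg (inj₁ 0<s) (*-monoʳ-≤-nonNeg (inj₁ 0<s) (≤-everywhere (inv s) (inv-pos 0<s))))

module Labellings where
  open import Data.Bool using (Bool; true; false; _∧_; not; _xor_; if_then_else_)
  open import Data.Bool.Properties using (∧-comm; ∧-assoc; xor-comm)
  open import Data.Fin using (zero; suc)
  open import Data.Fin.Subset using (Subset; _∩_; ∣_∣)
  open import Data.List using (List; []; _∷_; _++_; map)
  open import Data.List.Membership.Propositional using (_∈_)
  open import Data.List.Membership.Propositional.Properties using (∈-map⁺; ∈-map⁻; ∈-++⁺ˡ; ∈-++⁺ʳ; ∈-++⁻)
  open import Data.List.Relation.Unary.Any using (here)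
  open import Data.Nat using (zero; suc; _+_)
  open import Data.Nat.Properties using (+-suc; suc-injective)
  open import Data.Product using (_×_; _,_; ∃; Σ-syntax)
  open import Data.Sum using (_⊎_; inj₁; inj₂)
  open import Data.Vec using (Vec; []; _∷_; lookup; _[_]≔_)
  import Data.Vec as Vec
  open import Relation.Binary.PropositionalEquality

  -- A labelling records, for each element of S, whether it lies in one, both
  -- or none of the bases B₁, B₂; elements outside S are labelled free.
  data Label : Set where
    free one both none : Label

  admits : Label → Bool → Bool → Bool
  admits free _  _  = true
  admits one  b₁ b₂ = b₁ xor b₂
  admits both b₁ b₂ = b₁ ∧ b₂
  admits none b₁ b₂ = not b₁ ∧ not b₂

  Labelling : ℕ → Set
  Labelling = Vec Label

  fits : ∀ {n} → Labelling n → Subset n → Subset n → Bool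
  fits []      []        []        = true
  fits (l ∷ ℓ) (b₁ ∷ B₁) (b₂ ∷ B₂) = admits l b₁ b₂ ∧ fits ℓ B₁ B₂

  isOne : Label → Bool
  isOne one = true
  isOne _   = false

  isConstrained : Label → Bool
  isConstrained free = false
  isConstrained _    = true

  ones : ∀ {n} → Labelling n → Subset n
  ones = Vec.map isOne

  support : ∀ {n} → Labelling n → Subset n
  support = Vec.map isConstrained

  #both : ∀ {n} → Labelling n → ℕ
  #both []         = 0
  #both (both ∷ ℓ) = suc (#both ℓ)
  #both (_ ∷ ℓ)    = #both ℓ

  #none : ∀ {n} → Labelling n → ℕ
  #none []         = 0
  #none (none ∷ ℓ) = suc (#none ℓ)
  #none (_ ∷ ℓ)    = #none ℓ

  #fixed : ∀ {n} → Labelling n → ℕ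
  #fixed []         = 0
  #fixed (both ∷ ℓ) = suc (#fixed ℓ)
  #fixed (none ∷ ℓ) = suc (#fixed ℓ)
  #fixed (_ ∷ ℓ)    = #fixed ℓ

  allOne : ∀ {n} → Subset n → Labelling n
  allOne = Vec.map (λ s → if s then one else free)

  admits-sym : ∀ l b₁ b₂ → admits l b₁ b₂ ≡ admits l b₂ b₁
  admits-sym free _  _  = refl
  admits-sym one  b₁ b₂ = xor-comm b₁ b₂
  admits-sym both b₁ b₂ = ∧-comm b₁ b₂
  admits-sym none b₁ b₂ = ∧-comm (not b₁) (not b₂)

  fits-sym : ∀ {n} (ℓ : Labelling n) B₁ B₂ → fits ℓ B₁ B₂ ≡ fits ℓ B₂ B₁
  fits-sym []      []        []        = refl
  fits-sym (l ∷ ℓ) (b₁ ∷ B₁) (b₂ ∷ B₂) = cong₂ _∧_ (admits-sym l b₁ b₂) (fits-sym ℓ B₁ B₂)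

  fits⇒∣B₁∩support∣ : ∀ {n} (ℓ : Labelling n) B₁ B₂ → fits ℓ B₁ B₂ ≡ true →
                      ∣ B₁ ∩ support ℓ ∣ ≡ #both ℓ + ∣ ones ℓ ∩ B₁ ∣
  fits⇒∣B₁∩support∣ []         []           []           _ = refl
  fits⇒∣B₁∩support∣ (free ∷ ℓ) (true ∷ B₁)  (_ ∷ B₂)     fit = fits⇒∣B₁∩support∣ ℓ B₁ B₂ fit
  fits⇒∣B₁∩support∣ (free ∷ ℓ) (false ∷ B₁) (_ ∷ B₂)     fit = fits⇒∣B₁∩support∣ ℓ B₁ B₂ fit
  fits⇒∣B₁∩support∣ (one ∷ ℓ)  (true ∷ B₁)  (false ∷ B₂) fit =
    trans (cong suc (fits⇒∣B₁∩support∣ ℓ B₁ B₂ fit)) (sym (+-suc (#both ℓ) _))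
  fits⇒∣B₁∩support∣ (one ∷ ℓ)  (false ∷ B₁) (true ∷ B₂)  fit = fits⇒∣B₁∩support∣ ℓ B₁ B₂ fit
  fits⇒∣B₁∩support∣ (both ∷ ℓ) (true ∷ B₁)  (true ∷ B₂)  fit = cong suc (fits⇒∣B₁∩support∣ ℓ B₁ B₂ fit)
  fits⇒∣B₁∩support∣ (none ∷ ℓ) (false ∷ B₁) (false ∷ B₂) fit = fits⇒∣B₁∩support∣ ℓ B₁ B₂ fit
  fits⇒∣B₁∩support∣ (one ∷ ℓ)  (true ∷ B₁)  (true ∷ B₂)  ()
  fits⇒∣B₁∩support∣ (one ∷ ℓ)  (false ∷ B₁) (false ∷ B₂) ()
  fits⇒∣B₁∩support∣ (both ∷ ℓ) (false ∷ B₁) (_ ∷ B₂)     ()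
  fits⇒∣B₁∩support∣ (both ∷ ℓ) (true ∷ B₁)  (false ∷ B₂) ()
  fits⇒∣B₁∩support∣ (none ∷ ℓ) (true ∷ B₁)  (_ ∷ B₂)     ()
  fits⇒∣B₁∩support∣ (none ∷ ℓ) (false ∷ B₁) (true ∷ B₂)  ()

  fits⇒∣B₂∩support∣ : ∀ {n} (ℓ : Labelling n) B₁ B₂ → fits ℓ B₁ B₂ ≡ true →
                      ∣ B₂ ∩ support ℓ ∣ ≡ #both ℓ + ∣ ones ℓ ∩ B₂ ∣
  fits⇒∣B₂∩support∣ ℓ B₁ B₂ fit = fits⇒∣B₁∩support∣ ℓ B₂ B₁ (trans (fits-sym ℓ B₂ B₁) fit)

  fits⇒∣ones∩B₁∣+∣ones∩B₂∣ : ∀ {n} (ℓ : Labelling n) B₁ B₂ → fits ℓ B₁ B₂ ≡ true →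
                             ∣ ones ℓ ∩ B₁ ∣ + ∣ ones ℓ ∩ B₂ ∣ ≡ ∣ ones ℓ ∣
  fits⇒∣ones∩B₁∣+∣ones∩B₂∣ []         []           []           _ = refl
  fits⇒∣ones∩B₁∣+∣ones∩B₂∣ (free ∷ ℓ) (_ ∷ B₁)     (_ ∷ B₂)     fit = fits⇒∣ones∩B₁∣+∣ones∩B₂∣ ℓ B₁ B₂ fit
  fits⇒∣ones∩B₁∣+∣ones∩B₂∣ (one ∷ ℓ)  (true ∷ B₁)  (false ∷ B₂) fit = cong suc (fits⇒∣ones∩B₁∣+∣ones∩B₂∣ ℓ B₁ B₂ fit)
  fits⇒∣ones∩B₁∣+∣ones∩B₂∣ (one ∷ ℓ)  (false ∷ B₁) (true ∷ B₂)  fit =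
    trans (+-suc _ _) (cong suc (fits⇒∣ones∩B₁∣+∣ones∩B₂∣ ℓ B₁ B₂ fit))
  fits⇒∣ones∩B₁∣+∣ones∩B₂∣ (both ∷ ℓ) (true ∷ B₁)  (true ∷ B₂)  fit = fits⇒∣ones∩B₁∣+∣ones∩B₂∣ ℓ B₁ B₂ fit
  fits⇒∣ones∩B₁∣+∣ones∩B₂∣ (none ∷ ℓ) (false ∷ B₁) (false ∷ B₂) fit = fits⇒∣ones∩B₁∣+∣ones∩B₂∣ ℓ B₁ B₂ fit
  fits⇒∣ones∩B₁∣+∣ones∩B₂∣ (one ∷ ℓ)  (true ∷ B₁)  (true ∷ B₂)  ()
  fits⇒∣ones∩B₁∣+∣ones∩B₂∣ (one ∷ ℓ)  (false ∷ B₁) (false ∷ B₂) ()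
  fits⇒∣ones∩B₁∣+∣ones∩B₂∣ (both ∷ ℓ) (false ∷ B₁) (_ ∷ B₂)     ()
  fits⇒∣ones∩B₁∣+∣ones∩B₂∣ (both ∷ ℓ) (true ∷ B₁)  (false ∷ B₂) ()
  fits⇒∣ones∩B₁∣+∣ones∩B₂∣ (none ∷ ℓ) (true ∷ B₁)  (_ ∷ B₂)     ()
  fits⇒∣ones∩B₁∣+∣ones∩B₂∣ (none ∷ ℓ) (false ∷ B₁) (true ∷ B₂)  ()

  ∣support∣ : ∀ {n} (ℓ : Labelling n) → ∣ support ℓ ∣ ≡ #both ℓ + #none ℓ + ∣ ones ℓ ∣
  ∣support∣ []         = refl
  ∣support∣ (free ∷ ℓ) = ∣support∣ ℓ
  ∣support∣ (one ∷ ℓ)  = trans (cong suc (∣support∣ ℓ)) (sym (+-suc _ _))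
  ∣support∣ (both ∷ ℓ) = cong suc (∣support∣ ℓ)
  ∣support∣ (none ∷ ℓ) = trans (cong suc (∣support∣ ℓ)) (cong (_+ ∣ ones ℓ ∣) (sym (+-suc (#both ℓ) (#none ℓ))))

  labellings : ∀ {n} → Subset n → List (Labelling n)
  labellings []          = [] ∷ []
  labellings (false ∷ S) = map (free ∷_) (labellings S)
  labellings (true ∷ S)  = map (one ∷_) (labellings S) ++ (map (both ∷_) (labellings S) ++ map (none ∷_) (labellings S))

  ∈labellings⇒support : ∀ {n} (S : Subset n) {ℓ} → ℓ ∈ labellings S → support ℓ ≡ S
  ∈labellings⇒support [] (here refl) = refl
  ∈labellings⇒support (false ∷ S) ℓ∈ with ∈-map⁻ (free ∷_) ℓ∈
  ... | _ , ℓ′∈ , refl = cong (false ∷_) (∈labellings⇒support S ℓ′∈)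
  ∈labellings⇒support (true ∷ S) ℓ∈ with ∈-++⁻ (map (one ∷_) (labellings S)) ℓ∈
  ... | inj₁ ℓ∈₁ with ∈-map⁻ (one ∷_) ℓ∈₁
  ...   | _ , ℓ′∈ , refl = cong (true ∷_) (∈labellings⇒support S ℓ′∈)
  ∈labellings⇒support (true ∷ S) ℓ∈ | inj₂ ℓ∈₂ with ∈-++⁻ (map (both ∷_) (labellings S)) ℓ∈₂
  ... | inj₁ ℓ∈₃ with ∈-map⁻ (both ∷_) ℓ∈₃
  ...   | _ , ℓ′∈ , refl = cong (true ∷_) (∈labellings⇒support S ℓ′∈)
  ∈labellings⇒support (true ∷ S) ℓ∈ | inj₂ ℓ∈₂ | inj₂ ℓ∈₃ with ∈-map⁻ (none ∷_) ℓ∈₃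
  ...   | _ , ℓ′∈ , refl = cong (true ∷_) (∈labellings⇒support S ℓ′∈)

  diagonal : ∀ {n} → Subset n → Subset n → Labelling n
  diagonal []          []      = []
  diagonal (false ∷ S) (_ ∷ B) = free ∷ diagonal S B
  diagonal (true ∷ S)  (b ∷ B) = (if b then both else none) ∷ diagonal S B

  diagonal∈labellings : ∀ {n} (S B : Subset n) → diagonal S B ∈ labellings S
  diagonal∈labellings []          []          = here refl
  diagonal∈labellings (false ∷ S) (_ ∷ B)     = ∈-map⁺ (free ∷_) (diagonal∈labellings S B)
  diagonal∈labellings (true ∷ S)  (true ∷ B)  =
    ∈-++⁺ʳ (map (one ∷_) (labellings S)) (∈-++⁺ˡ (∈-map⁺ (both ∷_) (diagonal∈labellings S B)))
  diagonal∈labellings (true ∷ S)  (false ∷ B) =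
    ∈-++⁺ʳ (map (one ∷_) (labellings S)) (∈-++⁺ʳ (map (both ∷_) (labellings S)) (∈-map⁺ (none ∷_) (diagonal∈labellings S B)))

  fits-diagonal : ∀ {n} (S B : Subset n) → fits (diagonal S B) B B ≡ true
  fits-diagonal []          []          = refl
  fits-diagonal (false ∷ S) (_ ∷ B)     = fits-diagonal S B
  fits-diagonal (true ∷ S)  (true ∷ B)  = fits-diagonal S B
  fits-diagonal (true ∷ S)  (false ∷ B) = fits-diagonal S B

  ∣ones-diagonal∣ : ∀ {n} (S B : Subset n) → ∣ ones (diagonal S B) ∣ ≡ 0
  ∣ones-diagonal∣ []          []          = refl
  ∣ones-diagonal∣ (false ∷ S) (_ ∷ B)     = ∣ones-diagonal∣ S B
  ∣ones-diagonal∣ (true ∷ S)  (true ∷ B)  = ∣ones-diagonal∣ S B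
  ∣ones-diagonal∣ (true ∷ S)  (false ∷ B) = ∣ones-diagonal∣ S B

  ones-allOne : ∀ {n} (S : Subset n) → ones (allOne S) ≡ S
  ones-allOne []          = refl
  ones-allOne (true ∷ S)  = cong (true ∷_) (ones-allOne S)
  ones-allOne (false ∷ S) = cong (false ∷_) (ones-allOne S)

  #fixed≡0⇒allOne : ∀ {n} (ℓ : Labelling n) → #fixed ℓ ≡ 0 → ℓ ≡ allOne (ones ℓ)
  #fixed≡0⇒allOne []         _ = refl
  #fixed≡0⇒allOne (free ∷ ℓ) h = cong (free ∷_) (#fixed≡0⇒allOne ℓ h)
  #fixed≡0⇒allOne (one ∷ ℓ)  h = cong (one ∷_) (#fixed≡0⇒allOne ℓ h)

  Fixed : Label → Set
  Fixed l = l ≡ both ⊎ l ≡ none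

  fits-fill : ∀ {n} (ℓ : Labelling n) i l B₁ B₂ → lookup ℓ i ≡ free →
              fits (ℓ [ i ]≔ l) B₁ B₂ ≡ fits ℓ B₁ B₂ ∧ admits l (lookup B₁ i) (lookup B₂ i)
  fits-fill (_ ∷ ℓ) zero    l (b₁ ∷ B₁) (b₂ ∷ B₂) refl = ∧-comm (admits l b₁ b₂) (fits ℓ B₁ B₂)
  fits-fill (k ∷ ℓ) (suc i) l (b₁ ∷ B₁) (b₂ ∷ B₂) ℓᵢ≡free =
    trans (cong (admits k b₁ b₂ ∧_) (fits-fill ℓ i l B₁ B₂ ℓᵢ≡free)) (sym (∧-assoc (admits k b₁ b₂) _ _))

  ones-fill : ∀ {n} (ℓ : Labelling n) i {l} → lookup ℓ i ≡ free → Fixed l → ones (ℓ [ i ]≔ l) ≡ ones ℓ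
  ones-fill (_ ∷ ℓ) zero    refl (inj₁ refl) = refl
  ones-fill (_ ∷ ℓ) zero    refl (inj₂ refl) = refl
  ones-fill (k ∷ ℓ) (suc i) ℓᵢ≡free fixed = cong (isOne k ∷_) (ones-fill ℓ i ℓᵢ≡free fixed)

  unfill : ∀ {n} (ℓ : Labelling n) {c} → #fixed ℓ ≡ suc c →
           ∃ λ i → Σ[ ℓ₀ ∈ Labelling n ] Σ[ l ∈ Label ] lookup ℓ₀ i ≡ free × #fixed ℓ₀ ≡ c × Fixed l × ℓ ≡ ℓ₀ [ i ]≔ l
  unfill (both ∷ ℓ) h = zero , free ∷ ℓ , both , refl , suc-injective h , inj₁ refl , refl
  unfill (none ∷ ℓ) h = zero , free ∷ ℓ , none , refl , suc-injective h , inj₂ refl , refl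
  unfill (free ∷ ℓ) h with unfill ℓ h
  ... | i , ℓ₀ , l , ℓ₀ᵢ≡free , #ℓ₀ , fixed , refl = suc i , free ∷ ℓ₀ , l , ℓ₀ᵢ≡free , #ℓ₀ , fixed , refl
  unfill (one ∷ ℓ)  h with unfill ℓ h
  ... | i , ℓ₀ , l , ℓ₀ᵢ≡free , #ℓ₀ , fixed , refl = suc i , one ∷ ℓ₀ , l , ℓ₀ᵢ≡free , #ℓ₀ , fixed , refl

  fill-induction : ∀ {n} (P : Labelling n → Set) →
                   (∀ S → P (allOne S)) →
                   (∀ ℓ i l → lookup ℓ i ≡ free → Fixed l → P ℓ → P (ℓ [ i ]≔ l)) →
                   ∀ ℓ → P ℓ
  fill-induction P base step ℓ = go (#fixed ℓ) ℓ refl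
    where
    go : ∀ c ℓ → #fixed ℓ ≡ c → P ℓ
    go zero    ℓ h = subst P (sym (#fixed≡0⇒allOne ℓ h)) (base (ones ℓ))
    go (suc c) ℓ h with unfill ℓ h
    ... | i , ℓ₀ , l , ℓ₀ᵢ≡free , #ℓ₀ , fixed , refl = step ℓ₀ i l ℓ₀ᵢ≡free fixed (go c ℓ₀ #ℓ₀)

module Sums (F : CompleteOrderedField) where
  open CompleteOrderedField F
  open OrderedFieldProperties F
  open Theory F using (selectSum)
  open import Data.Bool using (Bool; true; false; _∧_)
  open import Data.Fin.Subset using (Subset)
  open import Data.Empty using (⊥-elim)
  open import Data.List using (List; []; _∷_; _++_; map)
  open import Data.List.Membership.Propositional using (_∈_)
  open import Data.List.Relation.Unary.Any using (here; there)
  open import Data.Product using (_×_; _,_; ∃)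
  open import Relation.Binary.PropositionalEquality
  open import Relation.Nullary using (¬_)
  open import Tactic.RingSolver.NonReflective almostCommutativeRing using (solve; _⊜_; _⊕_)

  ∑ : {X : Set} → List X → (X → R) → R
  ∑ []       f = 0#
  ∑ (x ∷ xs) f = f x + ∑ xs f

  syntax ∑ L (λ x → e) = ∑[ x ← L ] e

  when : Bool → R → R
  when true  x = x
  when false _ = 0#

  module _ {X : Set} where

    ∑-cong : ∀ (L : List X) {f g : X → R} → (∀ x → f x ≡ g x) → ∑ L f ≡ ∑ L g
    ∑-cong []      f≗g = refl
    ∑-cong (x ∷ L) f≗g = cong₂ _+_ (f≗g x) (∑-cong L f≗g)

    ∑-zero : ∀ (L : List X) → ∑[ x ← L ] 0# ≡ 0#
    ∑-zero []      = refl
    ∑-zero (x ∷ L) = trans (+-identityˡ _) (∑-zero L)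

    ∑-+ : ∀ (L : List X) (f g : X → R) → ∑[ x ← L ] (f x + g x) ≡ ∑ L f + ∑ L g
    ∑-+ []      f g = sym (+-identityˡ 0#)
    ∑-+ (x ∷ L) f g = trans (cong (f x + g x +_) (∑-+ L f g))
      (solve 4 (λ a b c d → ((a ⊕ b) ⊕ (c ⊕ d)) ⊜ ((a ⊕ c) ⊕ (b ⊕ d))) refl (f x) (g x) (∑ L f) (∑ L g))

    *-distribˡ-∑ : ∀ c (L : List X) (f : X → R) → c * ∑ L f ≡ ∑[ x ← L ] (c * f x)
    *-distribˡ-∑ c []      f = zeroʳ c
    *-distribˡ-∑ c (x ∷ L) f = trans (distribˡ c (f x) (∑ L f)) (cong (c * f x +_) (*-distribˡ-∑ c L f))

    *-distribʳ-∑ : ∀ c (L : List X) (f : X → R) → ∑ L f * c ≡ ∑[ x ← L ] (f x * c)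
    *-distribʳ-∑ c L f = trans (*-comm (∑ L f) c) (trans (*-distribˡ-∑ c L f) (∑-cong L λ x → *-comm c (f x)))

    ∑-++ : ∀ (L₁ L₂ : List X) (f : X → R) → ∑ (L₁ ++ L₂) f ≡ ∑ L₁ f + ∑ L₂ f
    ∑-++ []       L₂ f = sym (+-identityˡ _)
    ∑-++ (x ∷ L₁) L₂ f = trans (cong (f x +_) (∑-++ L₁ L₂ f)) (sym (+-assoc (f x) (∑ L₁ f) (∑ L₂ f)))

    ∑-map : ∀ {Y : Set} (g : Y → X) (L : List Y) (f : X → R) → ∑ (map g L) f ≡ ∑[ y ← L ] f (g y)
    ∑-map g []      f = refl
    ∑-map g (y ∷ L) f = cong (f (g y) +_) (∑-map g L f)

    ∑-mono : ∀ (L : List X) {f g : X → R} → (∀ x → x ∈ L → f x ≤ g x) → ∑ L f ≤ ∑ L g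
    ∑-mono []      f≤g = ≤-refl
    ∑-mono (x ∷ L) f≤g = +-mono-≤ (f≤g x (here refl)) (∑-mono L λ y y∈L → f≤g y (there y∈L))

    ∑-mono-< : ∀ (L : List X) {f g : X → R} → (∀ x → x ∈ L → f x ≤ g x) →
               ∀ {x₀} → x₀ ∈ L → f x₀ < g x₀ → ∑ L f < ∑ L g
    ∑-mono-< (x ∷ L) f≤g (here refl) fx<gx = +-mono-<-≤ fx<gx (∑-mono L λ y y∈L → f≤g y (there y∈L))
    ∑-mono-< (x ∷ L) f≤g (there x₀∈L) fx₀<gx₀ =
      +-mono-≤-< (f≤g x (here refl)) (∑-mono-< L (λ y y∈L → f≤g y (there y∈L)) x₀∈L fx₀<gx₀)

    ∑-nonNeg : ∀ (L : List X) {f : X → R} → (∀ x → 0# ≤ f x) → 0# ≤ ∑ L f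
    ∑-nonNeg L {f} 0≤f = subst (_≤ ∑ L f) (∑-zero L) (∑-mono L λ x _ → 0≤f x)

    ∑-pos : ∀ (L : List X) {f : X → R} → (∀ x → 0# ≤ f x) → ∀ {x₀} → x₀ ∈ L → 0# < f x₀ → 0# < ∑ L f
    ∑-pos L {f} 0≤f x₀∈L 0<fx₀ = subst (_< ∑ L f) (∑-zero L) (∑-mono-< L (λ x _ → 0≤f x) x₀∈L 0<fx₀)

  ∑-comm : ∀ {X Y : Set} (L₁ : List X) (L₂ : List Y) (f : X → Y → R) →
           ∑[ x ← L₁ ] ∑[ y ← L₂ ] f x y ≡ ∑[ y ← L₂ ] ∑[ x ← L₁ ] f x y
  ∑-comm []       L₂ f = sym (∑-zero L₂)
  ∑-comm (x ∷ L₁) L₂ f = trans (cong (∑ L₂ (f x) +_) (∑-comm L₁ L₂ f)) (sym (∑-+ L₂ (f x) _))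

  ∑-*-∑ : ∀ {X Y : Set} (L₁ : List X) (L₂ : List Y) (f : X → R) (g : Y → R) →
          ∑ L₁ f * ∑ L₂ g ≡ ∑[ x ← L₁ ] ∑[ y ← L₂ ] (f x * g y)
  ∑-*-∑ L₁ L₂ f g = trans (*-distribʳ-∑ (∑ L₂ g) L₁ f) (∑-cong L₁ λ x → *-distribˡ-∑ (f x) L₂ g)

  *-distribˡ-∑∑ : ∀ {X Y : Set} c (L₁ : List X) (L₂ : List Y) (f : X → Y → R) →
                  c * (∑[ x ← L₁ ] ∑[ y ← L₂ ] f x y) ≡ ∑[ x ← L₁ ] ∑[ y ← L₂ ] (c * f x y)
  *-distribˡ-∑∑ c L₁ L₂ f = trans (*-distribˡ-∑ c L₁ _) (∑-cong L₁ λ x → *-distribˡ-∑ c L₂ (f x))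

  when-∧ : ∀ a b x → when (a ∧ b) x ≡ when a (when b x)
  when-∧ true  b x = refl
  when-∧ false b x = refl

  when-*-when : ∀ a b x y → when a x * when b y ≡ when (a ∧ b) (x * y)
  when-*-when true  true  x y = refl
  when-*-when true  false x y = zeroʳ x
  when-*-when false b     x y = zeroˡ (when b y)

  *-when : ∀ a x y → x * when a y ≡ when a (x * y)
  *-when true  x y = refl
  *-when false x y = zeroʳ x

  when-∑ : ∀ {X : Set} a (L : List X) (f : X → R) → when a (∑ L f) ≡ ∑[ x ← L ] when a (f x)
  when-∑ true  L f = refl
  when-∑ false L f = sym (∑-zero L)

  when-cong : ∀ a {x y} → (a ≡ true → x ≡ y) → when a x ≡ when a y
  when-cong true  x≡y = x≡y refl
  when-cong false _   = refl

  when-nonNeg : ∀ a {x} → 0# ≤ x → 0# ≤ when a x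
  when-nonNeg true  0≤x = 0≤x
  when-nonNeg false _   = ≤-refl

  when-false : ∀ {a} x → ¬ (a ≡ true) → when a x ≡ 0#
  when-false {true}  x a≢true = ⊥-elim (a≢true refl)
  when-false {false} x _      = refl

  selectSum≡∑ : ∀ {n} (p : Subset n → Bool) (f : Subset n → R) L → selectSum p f L ≡ ∑[ x ← L ] when (p x) (f x)
  selectSum≡∑ p f []      = refl
  selectSum≡∑ p f (x ∷ L) with p x
  ... | true  = cong (f x +_) (selectSum≡∑ p f L)
  ... | false = trans (selectSum≡∑ p f L) (sym (+-identityˡ _))

  ∑-when≢0⇒∃ : ∀ {X : Set} (L : List X) (p : X → Bool) (f : X → R) →
               ¬ (∑[ x ← L ] when (p x) (f x) ≡ 0#) → ∃ λ x → x ∈ L × p x ≡ true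
  ∑-when≢0⇒∃ []      p f ∑≢0 = ⊥-elim (∑≢0 refl)
  ∑-when≢0⇒∃ (x ∷ L) p f ∑≢0 with p x in px
  ... | true  = x , here refl , px
  ... | false with ∑-when≢0⇒∃ L p f (λ ∑≡0 → ∑≢0 (trans (+-identityˡ _) ∑≡0))
  ...   | y , y∈L , py = y , there y∈L , py

module Monomials (F : CompleteOrderedField) where
  open CompleteOrderedField F
  open OrderedFieldProperties F
  open Theory F using (Weights; Positive; mono)
  open import Data.Bool using (Bool; true; false; if_then_else_)
  open import Data.Fin using (Fin; zero; suc)
  open import Data.Fin.Subset using (_─_)
  open import Data.Vec using ([]; _∷_; lookup)
  open import Data.Vec.Functional using (updateAt)
  open import Data.Vec.Functional.Properties using (updateAt-id-local)
  open import Function using (_∘_; const)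
  open import Relation.Binary.PropositionalEquality

  mono-pos : ∀ {n} {y : Weights n} → Positive y → ∀ B → 0# < mono y B
  mono-pos y>0 []          = 0<1
  mono-pos y>0 (true ∷ B)  = *-pos _ _ (y>0 zero) (mono-pos (y>0 ∘ suc) B)
  mono-pos y>0 (false ∷ B) = mono-pos (y>0 ∘ suc) B

  mono-cong : ∀ {n} {y z : Weights n} → (∀ i → y i ≡ z i) → ∀ B → mono y B ≡ mono z B
  mono-cong y≗z []          = refl
  mono-cong y≗z (true ∷ B)  = cong₂ _*_ (y≗z zero) (mono-cong (y≗z ∘ suc) B)
  mono-cong y≗z (false ∷ B) = mono-cong (y≗z ∘ suc) B

  mono-⊆ : ∀ {n} (y : Weights n) A B → (A ⊆ᵇ B) ≡ true → mono y A * mono y (B ─ A) ≡ mono y B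
  mono-⊆ y []          []          _ = *-identityʳ 1#
  mono-⊆ y (true ∷ A)  (true ∷ B)  A⊆B =
    trans (*-assoc (y zero) _ _) (cong (y zero *_) (mono-⊆ (y ∘ suc) A B A⊆B))
  mono-⊆ y (false ∷ A) (true ∷ B)  A⊆B =
    trans (*-x∙yz≈y∙xz _ (y zero) _) (cong (y zero *_) (mono-⊆ (y ∘ suc) A B A⊆B))
  mono-⊆ y (false ∷ A) (false ∷ B) A⊆B = mono-⊆ (y ∘ suc) A B A⊆B

  reweight : ∀ {n} → Weights n → Fin n → R → Weights n
  reweight y i t = updateAt y i (const t)

  factor : Bool → R → R
  factor b t = if b then t else 1#

  reweight-pos : ∀ {n} {y : Weights n} → Positive y → ∀ i {t} → 0# < t → Positive (reweight y i t)
  reweight-pos y>0 zero    t>0 zero    = t>0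
  reweight-pos y>0 zero    t>0 (suc j) = y>0 (suc j)
  reweight-pos y>0 (suc i) t>0 zero    = y>0 zero
  reweight-pos y>0 (suc i) t>0 (suc j) = reweight-pos (y>0 ∘ suc) i t>0 j

  mono-reweight : ∀ {n} (y : Weights n) i t B →
                  mono (reweight y i t) B ≡ factor (lookup B i) t * mono (reweight y i 1#) B
  mono-reweight y zero    t (true ∷ B)  = cong (t *_) (sym (*-identityˡ _))
  mono-reweight y zero    t (false ∷ B) = sym (*-identityˡ _)
  mono-reweight y (suc i) t (true ∷ B)  =
    trans (cong (y zero *_) (mono-reweight (y ∘ suc) i t B)) (*-x∙yz≈y∙xz (y zero) _ _)
  mono-reweight y (suc i) t (false ∷ B) = mono-reweight (y ∘ suc) i t B

  mono-factor : ∀ {n} (y : Weights n) i B → mono y B ≡ factor (lookup B i) (y i) * mono (reweight y i 1#) B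
  mono-factor y i B = trans (mono-cong (λ j → sym (updateAt-id-local i y refl j)) B) (mono-reweight y i (y i) B)

module PairSums (F : CompleteOrderedField) {n} (M : Matroid n) where
  open CompleteOrderedField F
  open OrderedFieldProperties F
  open Quadratics F
  open Sums F
  open Monomials F
  open Labellings
  open Theory F using (Weights; Positive; mono; bases)
  open import Data.Bool using (Bool; true; false; _∧_)
  open import Data.List using (List; []; _∷_)
  open import Data.Fin using (Fin)
  open import Data.Fin.Subset using (Subset)
  open import Data.List.Membership.Propositional using (_∈_)
  open import Data.Sum using (inj₁)
  open import Data.Vec using (lookup)
  open import Relation.Binary.PropositionalEquality
  open import Relation.Nullary using (¬_)
  open ≡-Reasoning

  PairPredicate : Set
  PairPredicate = Subset n → Subset n → Bool

  pairSum : PairPredicate → Weights n → R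
  pairSum φ y = ∑[ B₁ ← bases M ] ∑[ B₂ ← bases M ] when (φ B₁ B₂) (mono y B₁ * mono y B₂)

  _∧[_]_ : PairPredicate → Fin n → Label → PairPredicate
  (φ ∧[ i ] l) B₁ B₂ = φ B₁ B₂ ∧ admits l (lookup B₁ i) (lookup B₂ i)

  module _ {y : Weights n} where

    pairSum-cong : ∀ {φ ψ} → (∀ B₁ B₂ → φ B₁ B₂ ≡ ψ B₁ B₂) → pairSum φ y ≡ pairSum ψ y
    pairSum-cong φ≗ψ = ∑-cong (bases M) λ B₁ → ∑-cong (bases M) λ B₂ → cong (λ b → when b _) (φ≗ψ B₁ B₂)

    pairTerm-pos : Positive y → ∀ B₁ B₂ → 0# < mono y B₁ * mono y B₂
    pairTerm-pos y>0 B₁ B₂ = *-pos _ _ (mono-pos y>0 B₁) (mono-pos y>0 B₂)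

    pairSum-nonNeg : Positive y → ∀ φ → 0# ≤ pairSum φ y
    pairSum-nonNeg y>0 φ = ∑-nonNeg (bases M) λ B₁ → ∑-nonNeg (bases M) λ B₂ →
      when-nonNeg (φ B₁ B₂) (inj₁ (pairTerm-pos y>0 B₁ B₂))

    pairSum-pos : Positive y → ∀ φ {B₁ B₂} → B₁ ∈ bases M → B₂ ∈ bases M → φ B₁ B₂ ≡ true → 0# < pairSum φ y
    pairSum-pos y>0 φ {B₁} {B₂} B₁∈ B₂∈ φB₁B₂ =
      ∑-pos (bases M) (λ B → ∑-nonNeg (bases M) (nonNeg B)) B₁∈
        (∑-pos (bases M) (nonNeg B₁) B₂∈ (subst (λ b → 0# < when b _) (sym φB₁B₂) (pairTerm-pos y>0 B₁ B₂)))
      where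
      nonNeg : ∀ B B′ → 0# ≤ when (φ B B′) (mono y B * mono y B′)
      nonNeg B B′ = when-nonNeg (φ B B′) (inj₁ (pairTerm-pos y>0 B B′))

    pairSum-unsatisfiable : ∀ {φ} → (∀ B₁ B₂ → ¬ (φ B₁ B₂ ≡ true)) → pairSum φ y ≡ 0#
    pairSum-unsatisfiable ¬φ =
      trans (∑-cong (bases M) λ B₁ → trans (∑-cong (bases M) λ B₂ → when-false _ (¬φ B₁ B₂)) (∑-zero (bases M)))
            (∑-zero (bases M))


  ∑-quad : ∀ {X : Set} (L : List X) t (f g h : X → R) →
           ∑[ x ← L ] quad t (f x) (g x) (h x) ≡ quad t (∑ L f) (∑ L g) (∑ L h)
  ∑-quad []      t f g h = sym (quad-zero t)
  ∑-quad (x ∷ L) t f g h = trans (cong (quad t (f x) (g x) (h x) +_) (∑-quad L t f g h)) (quad-additive t _ _ _ _ _ _)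

  pairTerm-reweight : ∀ φ b₁ b₂ t m₁ m₂ →
    when φ ((factor b₁ t * m₁) * (factor b₂ t * m₂)) ≡
      quad t (when (φ ∧ admits both b₁ b₂) (m₁ * m₂)) (when (φ ∧ admits one b₁ b₂) (m₁ * m₂))
             (when (φ ∧ admits none b₁ b₂) (m₁ * m₂))
  pairTerm-reweight false _     _     t m₁ m₂ = sym (quad-zero t)
  pairTerm-reweight true  true  true  t m₁ m₂ =
    trans (trans (*-interchange t m₁ t m₂) (*-assoc t t _)) (sym (quad-leading-only t _))
  pairTerm-reweight true  true  false t m₁ m₂ =
    trans (trans (cong ((t * m₁) *_) (*-identityˡ m₂)) (*-assoc t m₁ m₂)) (sym (quad-middle-only t _))
  pairTerm-reweight true  false true  t m₁ m₂ =
    trans (trans (cong (_* (t * m₂)) (*-identityˡ m₁)) (*-x∙yz≈y∙xz m₁ t m₂)) (sym (quad-middle-only t _))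
  pairTerm-reweight true  false false t m₁ m₂ =
    trans (cong₂ _*_ (*-identityˡ m₁) (*-identityˡ m₂)) (sym (quad-constant-only t _))

  pairSum-reweight : ∀ φ (y : Weights n) i t →
    pairSum φ (reweight y i t) ≡
      quad t (pairSum (φ ∧[ i ] both) (reweight y i 1#)) (pairSum (φ ∧[ i ] one) (reweight y i 1#))
             (pairSum (φ ∧[ i ] none) (reweight y i 1#))
  pairSum-reweight φ y i t =
    trans (∑-cong (bases M) λ B₁ → trans (∑-cong (bases M) λ B₂ → term B₁ B₂) (∑-quad (bases M) t _ _ _))
          (∑-quad (bases M) t _ _ _)
    where
    term : ∀ B₁ B₂ → when (φ B₁ B₂) (mono (reweight y i t) B₁ * mono (reweight y i t) B₂) ≡ _
    term B₁ B₂ = trans (cong (when (φ B₁ B₂)) (cong₂ _*_ (mono-reweight y i t B₁) (mono-reweight y i t B₂)))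
                       (pairTerm-reweight (φ B₁ B₂) (lookup B₁ i) (lookup B₂ i) t _ _)

  pairSum-both : ∀ φ (y : Weights n) i →
                 pairSum (φ ∧[ i ] both) y ≡ y i * (y i * pairSum (φ ∧[ i ] both) (reweight y i 1#))
  pairSum-both φ y i = begin
    pairSum (φ ∧[ i ] both) y
      ≡⟨ ∑-cong (bases M) (λ B₁ → ∑-cong (bases M) λ B₂ → term B₁ B₂) ⟩
    ∑[ B₁ ← bases M ] ∑[ B₂ ← bases M ] (y i * (y i * when ((φ ∧[ i ] both) B₁ B₂) _))
      ≡⟨ sym (trans (cong (y i *_) (*-distribˡ-∑∑ (y i) (bases M) (bases M) _))
                    (*-distribˡ-∑∑ (y i) (bases M) (bases M) _)) ⟩
    y i * (y i * pairSum (φ ∧[ i ] both) (reweight y i 1#)) ∎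
    where
    c*[c*0]≡0 : ∀ c → c * (c * 0#) ≡ 0#
    c*[c*0]≡0 c = trans (cong (c *_) (zeroʳ c)) (zeroʳ c)
    pairTerm : ∀ φ b₁ b₂ c m₁ m₂ → when (φ ∧ admits both b₁ b₂) ((factor b₁ c * m₁) * (factor b₂ c * m₂))
                                   ≡ c * (c * when (φ ∧ admits both b₁ b₂) (m₁ * m₂))
    pairTerm false _     _     c m₁ m₂ = sym (c*[c*0]≡0 c)
    pairTerm true  true  true  c m₁ m₂ = trans (*-interchange c m₁ c m₂) (*-assoc c c _)
    pairTerm true  true  false c m₁ m₂ = sym (c*[c*0]≡0 c)
    pairTerm true  false _     c m₁ m₂ = sym (c*[c*0]≡0 c)
    term : ∀ B₁ B₂ → when ((φ ∧[ i ] both) B₁ B₂) (mono y B₁ * mono y B₂) ≡ _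
    term B₁ B₂ = trans (cong (when ((φ ∧[ i ] both) B₁ B₂)) (cong₂ _*_ (mono-factor y i B₁) (mono-factor y i B₂)))
                       (pairTerm (φ B₁ B₂) (lookup B₁ i) (lookup B₂ i) (y i) _ _)

  pairSum-none : ∀ φ (y : Weights n) i → pairSum (φ ∧[ i ] none) y ≡ pairSum (φ ∧[ i ] none) (reweight y i 1#)
  pairSum-none φ y i = ∑-cong (bases M) λ B₁ → ∑-cong (bases M) λ B₂ →
    trans (cong (when ((φ ∧[ i ] none) B₁ B₂)) (cong₂ _*_ (mono-factor y i B₁) (mono-factor y i B₂)))
          (pairTerm (φ B₁ B₂) (lookup B₁ i) (lookup B₂ i) (y i) _ _)
    where
    pairTerm : ∀ φ b₁ b₂ c m₁ m₂ → when (φ ∧ admits none b₁ b₂) ((factor b₁ c * m₁) * (factor b₂ c * m₂))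
                                   ≡ when (φ ∧ admits none b₁ b₂) (m₁ * m₂)
    pairTerm false _     _     c m₁ m₂ = refl
    pairTerm true  false false c m₁ m₂ = cong₂ _*_ (*-identityˡ m₁) (*-identityˡ m₂)
    pairTerm true  false true  c m₁ m₂ = refl
    pairTerm true  true  _     c m₁ m₂ = refl

module ΨCondition where
  open import Data.Bool using (Bool; true; false; _∧_)
  open import Data.Bool.Properties using (∧-zeroʳ)
  open import Data.Fin.Subset using (Subset; _∩_; _─_)
  open import Data.Sum using (_⊎_; inj₁; inj₂)
  open import Data.Vec using ([]; _∷_)
  open import Relation.Binary.PropositionalEquality
  open Labellings

  _≐_ : ∀ {n} → Subset n → Subset n → Bool
  []          ≐ []          = true
  (true ∷ A)  ≐ (true ∷ B)  = A ≐ B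
  (false ∷ A) ≐ (false ∷ B) = A ≐ B
  (_ ∷ _)     ≐ (_ ∷ _)     = false

  ≐⇒≡ : ∀ {n} (A B : Subset n) → (A ≐ B) ≡ true → A ≡ B
  ≐⇒≡ []          []          _   = refl
  ≐⇒≡ (true ∷ A)  (true ∷ B)  A≐B = cong (true ∷_) (≐⇒≡ A B A≐B)
  ≐⇒≡ (false ∷ A) (false ∷ B) A≐B = cong (false ∷_) (≐⇒≡ A B A≐B)

  x∧[y∧z]≡false : ∀ x y z → y ≡ false ⊎ z ≡ false → x ∧ (y ∧ z) ≡ false
  x∧[y∧z]≡false x _ _ (inj₁ refl) = ∧-zeroʳ x
  x∧[y∧z]≡false x y _ (inj₂ refl) = trans (cong (x ∧_) (∧-zeroʳ y)) (∧-zeroʳ x)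

  -- Expanding Ψ_k M S over pairs of bases, (A, B₁, B₂) contributes iff A = S ∩ B₁
  -- and every element of S lies in exactly one of B₁, B₂.
  Ψ-condition : ∀ {n} (A S B₁ B₂ : Subset n) →
                (A ⊆ᵇ S) ∧ (((A ⊆ᵇ B₁) ∧ disjᵇ B₁ (S ─ A)) ∧ (((S ─ A) ⊆ᵇ B₂) ∧ disjᵇ B₂ A))
                  ≡ (A ≐ (S ∩ B₁)) ∧ fits (allOne S) B₁ B₂
  Ψ-condition []          []          []           []           = refl
  Ψ-condition (true ∷ A)  (false ∷ S) (_ ∷ B₁)     (_ ∷ B₂)     = refl
  Ψ-condition (false ∷ A) (false ∷ S) (true ∷ B₁)  (true ∷ B₂)  = Ψ-condition A S B₁ B₂
  Ψ-condition (false ∷ A) (false ∷ S) (true ∷ B₁)  (false ∷ B₂) = Ψ-condition A S B₁ B₂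
  Ψ-condition (false ∷ A) (false ∷ S) (false ∷ B₁) (true ∷ B₂)  = Ψ-condition A S B₁ B₂
  Ψ-condition (false ∷ A) (false ∷ S) (false ∷ B₁) (false ∷ B₂) = Ψ-condition A S B₁ B₂
  Ψ-condition (true ∷ A)  (true ∷ S)  (true ∷ B₁)  (false ∷ B₂) = Ψ-condition A S B₁ B₂
  Ψ-condition (false ∷ A) (true ∷ S)  (false ∷ B₁) (true ∷ B₂)  = Ψ-condition A S B₁ B₂
  Ψ-condition (true ∷ A)  (true ∷ S)  (true ∷ B₁)  (true ∷ B₂)  =
    trans (x∧[y∧z]≡false (A ⊆ᵇ S) ((A ⊆ᵇ B₁) ∧ disjᵇ B₁ (S ─ A)) _ (inj₂ (∧-zeroʳ ((S ─ A) ⊆ᵇ B₂))))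
          (sym (∧-zeroʳ (A ≐ (S ∩ B₁))))
  Ψ-condition (true ∷ A)  (true ∷ S)  (false ∷ B₁) (b₂ ∷ B₂)    =
    x∧[y∧z]≡false (A ⊆ᵇ S) false (((S ─ A) ⊆ᵇ B₂) ∧ disjᵇ (b₂ ∷ B₂) (true ∷ A)) (inj₁ refl)
  Ψ-condition (false ∷ A) (true ∷ S)  (true ∷ B₁)  (b₂ ∷ B₂)    =
    x∧[y∧z]≡false (A ⊆ᵇ S) ((A ⊆ᵇ B₁) ∧ false) (((true ∷ (S ─ A)) ⊆ᵇ (b₂ ∷ B₂)) ∧ disjᵇ (b₂ ∷ B₂) (false ∷ A))
      (inj₁ (∧-zeroʳ (A ⊆ᵇ B₁)))
  Ψ-condition (false ∷ A) (true ∷ S)  (false ∷ B₁) (false ∷ B₂) =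
    trans (x∧[y∧z]≡false (A ⊆ᵇ S) ((A ⊆ᵇ B₁) ∧ disjᵇ B₁ (S ─ A)) false (inj₂ refl)) (sym (∧-zeroʳ (A ≐ (S ∩ B₁))))

module LabelledRays (F : CompleteOrderedField) {n} (M : Matroid n) where
  open CompleteOrderedField F
  open OrderedFieldProperties F
  open Sums F
  open Monomials F
  open PairSums F M
  open Labellings
  open ΨCondition
  open Quadratics F
  open Theory F using (Weights; Positive; mono; bases; MIJ; Ψ; Ray)
  open import Algebra.Bundles using (CommutativeMonoid)
  open import Data.Bool using (Bool; true; false; _∧_)
  open import Data.Bool.Properties using (∧-assoc; ∧-conicalˡ; ∧-conicalʳ; ∧-commutativeMonoid)
  open import Data.Fin.Subset using (Subset; _∩_; _─_; ∣_∣)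
  open import Data.List using (map; _++_)
  open import Data.Nat using (zero; suc; _≡ᵇ_) renaming (_+_ to _+ℕ_)
  open import Data.Sum using (inj₁; inj₂)
  open import Data.Vec using ([]; _∷_; lookup; _[_]≔_)
  open import Relation.Binary.PropositionalEquality
  open import Algebra.Properties.CommutativeSemigroup (CommutativeMonoid.commutativeSemigroup ∧-commutativeMonoid)
    using () renaming (xy∙z≈xz∙y to [x∧y]∧z≡[x∧z]∧y)
  open ≡-Reasoning

  fitsWith : Labelling n → ℕ → PairPredicate
  fitsWith ℓ k B₁ B₂ = fits ℓ B₁ B₂ ∧ (∣ ones ℓ ∩ B₁ ∣ ≡ᵇ k)

  -- Writing I, J, T for the elements labelled both, none, one, this is
  -- y^{2I}·y^T·Ψ_k(M/I∖J, T)(y); Ψ-as-labelledΨ is the case I = J = ∅.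
  labelledΨ : Labelling n → ℕ → Weights n → R
  labelledΨ ℓ k = pairSum (fitsWith ℓ k)

  LabelledRay : Labelling n → ℕ → R → Set
  LabelledRay ℓ k c = ∀ y → Positive y → c * labelledΨ ℓ (suc k) y ≤ labelledΨ ℓ k y

  ∑-≐ : ∀ {m} (X : Subset m) c → ∑[ A ← subsets m ] when (A ≐ X) c ≡ c
  ∑-≐ {zero}  []      c = +-identityʳ c
  ∑-≐ {suc m} (x ∷ X) c = begin
    ∑ (map (false ∷_) (subsets m) ++ map (true ∷_) (subsets m)) (λ A → when (A ≐ (x ∷ X)) c)
      ≡⟨ ∑-++ (map (false ∷_) (subsets m)) _ _ ⟩
    ∑ (map (false ∷_) (subsets m)) (λ A → when (A ≐ (x ∷ X)) c) + ∑ (map (true ∷_) (subsets m)) (λ A → when (A ≐ (x ∷ X)) c)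
      ≡⟨ cong₂ _+_ (∑-map (false ∷_) (subsets m) _) (∑-map (true ∷_) (subsets m) _) ⟩
    ∑[ A ← subsets m ] when ((false ∷ A) ≐ (x ∷ X)) c + ∑[ A ← subsets m ] when ((true ∷ A) ≐ (x ∷ X)) c
      ≡⟨ by-head x ⟩
    c ∎
    where
    by-head : ∀ x → ∑[ A ← subsets m ] when ((false ∷ A) ≐ (x ∷ X)) c + ∑[ A ← subsets m ] when ((true ∷ A) ≐ (x ∷ X)) c ≡ c
    by-head true  = trans (cong₂ _+_ (∑-zero (subsets m)) (∑-≐ X c)) (+-identityˡ c)
    by-head false = trans (cong₂ _+_ (∑-≐ X c) (∑-zero (subsets m))) (+-identityʳ c)

  module _ (k : ℕ) (S : Subset n) (y : Weights n) where

    private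
      inS : Subset n → Bool
      inS A = (A ⊆ᵇ S) ∧ (∣ A ∣ ≡ᵇ k)
      left : Subset n → Subset n → Bool
      left A B₁ = (A ⊆ᵇ B₁) ∧ disjᵇ B₁ (S ─ A)
      right : Subset n → Subset n → Bool
      right A B₂ = ((S ─ A) ⊆ᵇ B₂) ∧ disjᵇ B₂ A
      condition : Subset n → Subset n → Subset n → Bool
      condition A B₁ B₂ = inS A ∧ (left A B₁ ∧ right A B₂)

    Ψ-monomial : ∀ A B₁ B₂ → (A ⊆ᵇ S) ≡ true → (A ⊆ᵇ B₁) ≡ true → ((S ─ A) ⊆ᵇ B₂) ≡ true →
                 mono y S * (mono y (B₁ ─ A) * mono y (B₂ ─ (S ─ A))) ≡ mono y B₁ * mono y B₂
    Ψ-monomial A B₁ B₂ A⊆S A⊆B₁ S─A⊆B₂ = begin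
      mono y S * (mono y (B₁ ─ A) * mono y (B₂ ─ (S ─ A)))
        ≡⟨ cong (_* (mono y (B₁ ─ A) * mono y (B₂ ─ (S ─ A)))) (sym (mono-⊆ y A S A⊆S)) ⟩
      (mono y A * mono y (S ─ A)) * (mono y (B₁ ─ A) * mono y (B₂ ─ (S ─ A)))
        ≡⟨ *-interchange _ _ _ _ ⟩
      (mono y A * mono y (B₁ ─ A)) * (mono y (S ─ A) * mono y (B₂ ─ (S ─ A)))
        ≡⟨ cong₂ _*_ (mono-⊆ y A B₁ A⊆B₁) (mono-⊆ y (S ─ A) B₂ S─A⊆B₂) ⟩
      mono y B₁ * mono y B₂ ∎

    Ψ-summand : ∀ A → mono y S * when (inS A) (MIJ M A (S ─ A) y * MIJ M (S ─ A) A y)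
                      ≡ ∑[ B₁ ← bases M ] ∑[ B₂ ← bases M ] when (condition A B₁ B₂) (mono y B₁ * mono y B₂)
    Ψ-summand A = begin
      mono y S * when (inS A) (MIJ M A (S ─ A) y * MIJ M (S ─ A) A y)
        ≡⟨ cong (λ x → mono y S * when (inS A) x)
             (trans (cong₂ _*_ (selectSum≡∑ _ _ (bases M)) (selectSum≡∑ _ _ (bases M))) (∑-*-∑ (bases M) (bases M) _ _)) ⟩
      mono y S * when (inS A) (∑[ B₁ ← bases M ] ∑[ B₂ ← bases M ] (m₁ B₁ * m₂ B₂))
        ≡⟨ cong (mono y S *_) (trans (when-∑ (inS A) (bases M) _) (∑-cong (bases M) λ B₁ → when-∑ (inS A) (bases M) _)) ⟩
      mono y S * (∑[ B₁ ← bases M ] ∑[ B₂ ← bases M ] when (inS A) (m₁ B₁ * m₂ B₂))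
        ≡⟨ *-distribˡ-∑∑ (mono y S) (bases M) (bases M) _ ⟩
      ∑[ B₁ ← bases M ] ∑[ B₂ ← bases M ] (mono y S * when (inS A) (m₁ B₁ * m₂ B₂))
        ≡⟨ ∑-cong (bases M) (λ B₁ → ∑-cong (bases M) λ B₂ → term B₁ B₂) ⟩
      ∑[ B₁ ← bases M ] ∑[ B₂ ← bases M ] when (condition A B₁ B₂) (mono y B₁ * mono y B₂) ∎
      where
      m₁ m₂ : Subset n → R
      m₁ B₁ = when (left A B₁) (mono y (B₁ ─ A))
      m₂ B₂ = when (right A B₂) (mono y (B₂ ─ (S ─ A)))
      term : ∀ B₁ B₂ → mono y S * when (inS A) (m₁ B₁ * m₂ B₂) ≡ when (condition A B₁ B₂) (mono y B₁ * mono y B₂)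
      term B₁ B₂ = begin
        mono y S * when (inS A) (m₁ B₁ * m₂ B₂)
          ≡⟨ cong (λ x → mono y S * when (inS A) x) (when-*-when (left A B₁) (right A B₂) _ _) ⟩
        mono y S * when (inS A) (when (left A B₁ ∧ right A B₂) _)
          ≡⟨ cong (mono y S *_) (sym (when-∧ (inS A) _ _)) ⟩
        mono y S * when (condition A B₁ B₂) _
          ≡⟨ *-when (condition A B₁ B₂) (mono y S) _ ⟩
        when (condition A B₁ B₂) (mono y S * (mono y (B₁ ─ A) * mono y (B₂ ─ (S ─ A))))
          ≡⟨ when-cong (condition A B₁ B₂) (λ c → Ψ-monomial A B₁ B₂
               (∧-conicalˡ (A ⊆ᵇ S) _ (∧-conicalˡ (inS A) _ c))
               (∧-conicalˡ (A ⊆ᵇ B₁) _ (∧-conicalˡ (left A B₁) _ (∧-conicalʳ (inS A) _ c)))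
               (∧-conicalˡ ((S ─ A) ⊆ᵇ B₂) _ (∧-conicalʳ (left A B₁) _ (∧-conicalʳ (inS A) _ c)))) ⟩
        when (condition A B₁ B₂) (mono y B₁ * mono y B₂) ∎

    ∑-Ψ-condition : ∀ B₁ B₂ → ∑[ A ← subsets n ] when (condition A B₁ B₂) (mono y B₁ * mono y B₂)
                              ≡ when (fitsWith (allOne S) k B₁ B₂) (mono y B₁ * mono y B₂)
    ∑-Ψ-condition B₁ B₂ = begin
      ∑[ A ← subsets n ] when (condition A B₁ B₂) w
        ≡⟨ ∑-cong (subsets n) (λ A → cong (λ b → when b w) (condition≡ A)) ⟩
      ∑[ A ← subsets n ] when ((A ≐ (S ∩ B₁)) ∧ (fits (allOne S) B₁ B₂ ∧ (∣ A ∣ ≡ᵇ k))) w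
        ≡⟨ ∑-cong (subsets n) (λ A → trans (when-∧ (A ≐ (S ∩ B₁)) _ w)
             (when-cong (A ≐ (S ∩ B₁)) λ A≐S∩B₁ →
               cong (λ X → when (fits (allOne S) B₁ B₂ ∧ (∣ X ∣ ≡ᵇ k)) w) (≐⇒≡ A _ A≐S∩B₁))) ⟩
      ∑[ A ← subsets n ] when (A ≐ (S ∩ B₁)) (when (fits (allOne S) B₁ B₂ ∧ (∣ S ∩ B₁ ∣ ≡ᵇ k)) w)
        ≡⟨ ∑-≐ (S ∩ B₁) _ ⟩
      when (fits (allOne S) B₁ B₂ ∧ (∣ S ∩ B₁ ∣ ≡ᵇ k)) w
        ≡⟨ cong (λ T → when (fits (allOne S) B₁ B₂ ∧ (∣ T ∩ B₁ ∣ ≡ᵇ k)) w) (sym (ones-allOne S)) ⟩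
      when (fitsWith (allOne S) k B₁ B₂) w ∎
      where
      w = mono y B₁ * mono y B₂
      condition≡ : ∀ A → condition A B₁ B₂ ≡ (A ≐ (S ∩ B₁)) ∧ (fits (allOne S) B₁ B₂ ∧ (∣ A ∣ ≡ᵇ k))
      condition≡ A = begin
        ((A ⊆ᵇ S) ∧ (∣ A ∣ ≡ᵇ k)) ∧ (left A B₁ ∧ right A B₂)
          ≡⟨ [x∧y]∧z≡[x∧z]∧y (A ⊆ᵇ S) _ _ ⟩
        ((A ⊆ᵇ S) ∧ (left A B₁ ∧ right A B₂)) ∧ (∣ A ∣ ≡ᵇ k)
          ≡⟨ cong (_∧ (∣ A ∣ ≡ᵇ k)) (Ψ-condition A S B₁ B₂) ⟩
        ((A ≐ (S ∩ B₁)) ∧ fits (allOne S) B₁ B₂) ∧ (∣ A ∣ ≡ᵇ k)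
          ≡⟨ ∧-assoc (A ≐ (S ∩ B₁)) _ _ ⟩
        (A ≐ (S ∩ B₁)) ∧ (fits (allOne S) B₁ B₂ ∧ (∣ A ∣ ≡ᵇ k)) ∎

    Ψ-as-labelledΨ : mono y S * Ψ M k S y ≡ labelledΨ (allOne S) k y
    Ψ-as-labelledΨ = begin
      mono y S * Ψ M k S y
        ≡⟨ trans (cong (mono y S *_) (selectSum≡∑ _ _ (subsets n))) (*-distribˡ-∑ (mono y S) (subsets n) _) ⟩
      ∑[ A ← subsets n ] (mono y S * when (inS A) (MIJ M A (S ─ A) y * MIJ M (S ─ A) A y))
        ≡⟨ ∑-cong (subsets n) Ψ-summand ⟩
      ∑[ A ← subsets n ] ∑[ B₁ ← bases M ] ∑[ B₂ ← bases M ] when (condition A B₁ B₂) (mono y B₁ * mono y B₂)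
        ≡⟨ trans (∑-comm (subsets n) (bases M) _) (∑-cong (bases M) λ B₁ → ∑-comm (subsets n) (bases M) _) ⟩
      ∑[ B₁ ← bases M ] ∑[ B₂ ← bases M ] ∑[ A ← subsets n ] when (condition A B₁ B₂) (mono y B₁ * mono y B₂)
        ≡⟨ ∑-cong (bases M) (λ B₁ → ∑-cong (bases M) λ B₂ → ∑-Ψ-condition B₁ B₂) ⟩
      labelledΨ (allOne S) k y ∎

  ray⇒labelledRay-allOne : ∀ {k c} → Ray M k c → ∀ S → ∣ S ∣ ≡ k +ℕ k → LabelledRay (allOne S) k c
  ray⇒labelledRay-allOne {k} {c} ray S ∣S∣≡2k y y>0 =
    subst₂ _≤_ scaled (Ψ-as-labelledΨ k S y) (*-monoʳ-≤-nonNeg (inj₁ (mono-pos y>0 S)) (ray y y>0 S ∣S∣≡2k))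
    where
    scaled : mono y S * (c * Ψ M (suc k) S y) ≡ c * labelledΨ (allOne S) (suc k) y
    scaled = trans (*-x∙yz≈y∙xz (mono y S) c _) (cong (c *_) (Ψ-as-labelledΨ (suc k) S y))

  fitsWith-fill : ∀ {ℓ i l} → lookup ℓ i ≡ free → Fixed l →
                  ∀ k B₁ B₂ → fitsWith (ℓ [ i ]≔ l) k B₁ B₂ ≡ (fitsWith ℓ k ∧[ i ] l) B₁ B₂
  fitsWith-fill {ℓ} {i} {l} ℓᵢ≡free fixed k B₁ B₂ = begin
    fits (ℓ [ i ]≔ l) B₁ B₂ ∧ (∣ ones (ℓ [ i ]≔ l) ∩ B₁ ∣ ≡ᵇ k)
      ≡⟨ cong₂ (λ b T → b ∧ (∣ T ∩ B₁ ∣ ≡ᵇ k)) (fits-fill ℓ i l B₁ B₂ ℓᵢ≡free) (ones-fill ℓ i ℓᵢ≡free fixed) ⟩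
    (fits ℓ B₁ B₂ ∧ admits l (lookup B₁ i) (lookup B₂ i)) ∧ (∣ ones ℓ ∩ B₁ ∣ ≡ᵇ k)
      ≡⟨ [x∧y]∧z≡[x∧z]∧y (fits ℓ B₁ B₂) _ _ ⟩
    (fitsWith ℓ k ∧[ i ] l) B₁ B₂ ∎

  -- Ray passes to minors: with y_i = t both sides are quadratics in t > 0, and
  -- comparing leading coefficients contracts i while comparing constant terms deletes it.
  labelledRay-fill : ∀ {ℓ i l k c} → lookup ℓ i ≡ free → Fixed l → LabelledRay ℓ k c → LabelledRay (ℓ [ i ]≔ l) k c
  labelledRay-fill {ℓ} {i} {l} {k} {c} ℓᵢ≡free fixed ray y y>0 =
    subst₂ (λ u v → c * u ≤ v) (sym (labelledΨ-fill (suc k))) (sym (labelledΨ-fill k)) (fill fixed)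
    where
    labelledΨ-fill : ∀ k → labelledΨ (ℓ [ i ]≔ l) k y ≡ pairSum (fitsWith ℓ k ∧[ i ] l) y
    labelledΨ-fill k = pairSum-cong (fitsWith-fill {ℓ} {i} ℓᵢ≡free fixed k)
    P : ℕ → Label → R
    P k l = pairSum (fitsWith ℓ k ∧[ i ] l) (reweight y i 1#)
    coefficientwise : ∀ t → 0# < t → quad t (c * P (suc k) both) (c * P (suc k) one) (c * P (suc k) none)
                                      ≤ quad t (P k both) (P k one) (P k none)
    coefficientwise t 0<t =
      subst₂ _≤_ (trans (cong (c *_) (pairSum-reweight (fitsWith ℓ (suc k)) y i t)) (quad-scale c t _ _ _))
                 (pairSum-reweight (fitsWith ℓ k) y i t)
        (ray (reweight y i t) (reweight-pos y>0 i 0<t))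
    fill : ∀ {l} → Fixed l → c * pairSum (fitsWith ℓ (suc k) ∧[ i ] l) y ≤ pairSum (fitsWith ℓ k ∧[ i ] l) y
    fill (inj₁ refl) =
      subst₂ _≤_ (sym (trans (cong (c *_) (pairSum-both (fitsWith ℓ (suc k)) y i))
                             (trans (*-x∙yz≈y∙xz c (y i) _) (cong (y i *_) (*-x∙yz≈y∙xz c (y i) _)))))
                 (sym (pairSum-both (fitsWith ℓ k) y i))
        (*-monoʳ-≤-nonNeg (inj₁ (y>0 i)) (*-monoʳ-≤-nonNeg (inj₁ (y>0 i)) (quad-leading-≤ coefficientwise)))
    fill (inj₂ refl) =
      subst₂ _≤_ (cong (c *_) (sym (pairSum-none (fitsWith ℓ (suc k)) y i))) (sym (pairSum-none (fitsWith ℓ k) y i))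
        (quad-constant-≤ coefficientwise)

  ray⇒labelledRay : ∀ {k c} → Ray M k c → ∀ ℓ → ∣ ones ℓ ∣ ≡ k +ℕ k → LabelledRay ℓ k c
  ray⇒labelledRay {k} {c} ray = fill-induction (λ ℓ → ∣ ones ℓ ∣ ≡ k +ℕ k → LabelledRay ℓ k c)
    (λ S ∣S∣≡2k → ray⇒labelledRay-allOne ray S (trans (cong ∣_∣ (sym (ones-allOne S))) ∣S∣≡2k))
    (λ ℓ i l ℓᵢ≡free fixed labelledRay ∣ones∣≡2k →
      labelledRay-fill {ℓ} {i} ℓᵢ≡free fixed (labelledRay (trans (cong ∣_∣ (sym (ones-fill ℓ i ℓᵢ≡free fixed))) ∣ones∣≡2k)))

module CountArithmetic where
  open import Data.Bool using (true; false; _∧_)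
  open import Data.Bool.Properties using (T-≡)
  open import Data.Empty using (⊥-elim)
  open import Data.Nat
  open import Data.Nat.Properties
  open import Data.Nat.Tactic.RingSolver using (solve-∀)
  open import Data.Product using (_×_; _,_)
  open import Function.Bundles using (Equivalence)
  open import Relation.Binary.PropositionalEquality
  open import Relation.Nullary using (yes; no)

  ≡ᵇ-cancelˡ : ∀ a x y → (a + x ≡ᵇ a + y) ≡ (x ≡ᵇ y)
  ≡ᵇ-cancelˡ zero    x y = refl
  ≡ᵇ-cancelˡ (suc a) x y = ≡ᵇ-cancelˡ a x y

  ≡ᵇ-true⇒≡ : ∀ {m n} → (m ≡ᵇ n) ≡ true → m ≡ n
  ≡ᵇ-true⇒≡ {m} {n} m≡ᵇn = ≡ᵇ⇒≡ m n (Equivalence.from T-≡ m≡ᵇn)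

  ≡ᵇ-∧-determined : ∀ {x₁ x₂ u v} → x₁ + x₂ ≡ u + v → (x₁ ≡ᵇ u) ∧ (x₂ ≡ᵇ v) ≡ (x₁ ≡ᵇ u)
  ≡ᵇ-∧-determined {x₁} {x₂} {u} {v} x₁+x₂≡u+v with x₁ ≡ᵇ u in x₁≡ᵇu
  ... | false = refl
  ... | true  = Equivalence.to T-≡ (≡⇒≡ᵇ x₂ v (+-cancelˡ-≡ u x₂ v (trans (cong (_+ x₂) (sym x₁≡u)) x₁+x₂≡u+v)))
    where
    x₁≡u : x₁ ≡ u
    x₁≡u = ≡ᵇ-true⇒≡ x₁≡ᵇu

  counts-≡ᵇ : ∀ a {x₁ x₂ u v} → x₁ + x₂ ≡ u + v → (a + x₁ ≡ᵇ a + u) ∧ (a + x₂ ≡ᵇ a + v) ≡ (x₁ ≡ᵇ u)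
  counts-≡ᵇ a {x₁} {x₂} {u} {v} x₁+x₂≡u+v =
    trans (cong₂ _∧_ (≡ᵇ-cancelˡ a x₁ u) (≡ᵇ-cancelˡ a x₂ v)) (≡ᵇ-∧-determined {x₁} {x₂} {u} {v} x₁+x₂≡u+v)

  spread-arithmetic : ∀ {a x₁ x₂ j′ t} → a + x₁ ≡ 2 + j′ → a + x₂ ≡ j′ → x₁ + x₂ ≡ t →
                      a ≤ j′ × t ≡ suc (j′ ∸ a) + suc (j′ ∸ a)
  spread-arithmetic {a} {x₁} {x₂} a+x₁≡2+j′ refl refl = m≤m+n a x₂ , x₁+x₂≡
    where
    open ≡-Reasoning
    shift : ∀ a x → 2 + (a + x) ≡ a + (2 + x)
    shift = solve-∀
    double : ∀ x → 2 + x + x ≡ suc x + suc x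
    double = solve-∀
    x₁≡2+x₂ : x₁ ≡ 2 + x₂
    x₁≡2+x₂ = +-cancelˡ-≡ a x₁ (2 + x₂) (trans a+x₁≡2+j′ (shift a x₂))
    x₁+x₂≡ : x₁ + x₂ ≡ suc (a + x₂ ∸ a) + suc (a + x₂ ∸ a)
    x₁+x₂≡ = begin
      x₁ + x₂                               ≡⟨ cong (_+ x₂) x₁≡2+x₂ ⟩
      2 + x₂ + x₂                           ≡⟨ double x₂ ⟩
      suc x₂ + suc x₂                       ≡⟨ cong (λ k → suc k + suc k) (sym (m+n∸m≡n a x₂)) ⟩
      suc (a + x₂ ∸ a) + suc (a + x₂ ∸ a)   ∎

  double≤odd⇒≤ : ∀ {k m} → k + k ≤ suc (2 * m) → k ≤ m
  double≤odd⇒≤ {k} {m} 2k≤2m+1 with k ≤? m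
  ... | yes k≤m = k≤m
  ... | no  k≰m = ⊥-elim (<⇒≱ (subst (_≤ k + k) (2+2m m) (+-mono-≤ (≰⇒> k≰m) (≰⇒> k≰m))) 2k≤2m+1)
    where
    2+2m : ∀ m → suc m + suc m ≡ 2 + 2 * m
    2+2m = solve-∀

  balanced-bounds : ∀ a b k′ → suc k′ ≤ suc (a + k′) × suc k′ ≤ a + b + (suc k′ + suc k′) ∸ suc (a + k′)
  balanced-bounds a b k′ = s≤s (m≤n+m k′ a) , subst (suc k′ ≤_) (sym remainder) (m≤n+m (suc k′) b)
    where
    split : ∀ a b k′ → a + b + (suc k′ + suc k′) ≡ suc (a + k′) + (b + suc k′)
    split = solve-∀
    remainder : a + b + (suc k′ + suc k′) ∸ suc (a + k′) ≡ b + suc k′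
    remainder = trans (cong (_∸ suc (a + k′)) (split a b k′)) (m+n∸m≡n (suc (a + k′)) (b + suc k′))

module RayToLogConcavity (F : CompleteOrderedField) where
  open CompleteOrderedField F
  open OrderedFieldProperties F
  open Sums F
  open Monomials F
  open Labellings
  open CountArithmetic
  open Theory F using (Weights; Positive; mono; bases; Mj; Ray)
  open import Data.Bool using (Bool; true; false; _∧_)
  open import Data.Bool.Properties using (∧-conicalˡ; ∧-conicalʳ)
  open import Data.Fin.Subset using (Subset; _∩_; ∣_∣)
  open import Data.List using (map; _++_)
  open import Data.List.Membership.Propositional using (_∈_)
  open import Data.Nat using (suc; _∸_; _≡ᵇ_; z≤n; s≤s; _≤?_; _≟_)
    renaming (_+_ to _+ℕ_; _*_ to _*ℕ_; _≤_ to _≤ℕ_)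
  open import Data.Nat.Properties using (m+[n∸m]≡n; m≤n+m; +-suc; 0≢1+n)
  import Data.Nat.Properties as Nat
  open import Data.Product using (_×_; _,_; proj₁; proj₂)
  open import Data.Vec using ([]; _∷_)
  open import Relation.Binary.PropositionalEquality
  open import Relation.Nullary using (¬_; yes; no)
  open ≡-Reasoning

  ∑-fits : ∀ {m} (S B₁ B₂ : Subset m) c → ∑[ ℓ ← labellings S ] when (fits ℓ B₁ B₂) c ≡ c
  ∑-fits []          []        []        c = +-identityʳ c
  ∑-fits (false ∷ S) (_ ∷ B₁)  (_ ∷ B₂)  c = trans (∑-map (free ∷_) (labellings S) _) (∑-fits S B₁ B₂ c)
  ∑-fits (true ∷ S)  (b₁ ∷ B₁) (b₂ ∷ B₂) c = trans by-label (exactly-one b₁ b₂)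
    where
    L = labellings S
    part : Label → Bool → Bool → R
    part l b₁ b₂ = ∑[ ℓ ← L ] when (admits l b₁ b₂ ∧ fits ℓ B₁ B₂) c
    f = λ ℓ → when (fits ℓ (b₁ ∷ B₁) (b₂ ∷ B₂)) c
    by-label : ∑ (map (one ∷_) L ++ (map (both ∷_) L ++ map (none ∷_) L)) f
               ≡ part one b₁ b₂ + (part both b₁ b₂ + part none b₁ b₂)
    by-label = begin
      ∑ (map (one ∷_) L ++ (map (both ∷_) L ++ map (none ∷_) L)) f
        ≡⟨ trans (∑-++ (map (one ∷_) L) _ f) (cong (∑ (map (one ∷_) L) f +_) (∑-++ (map (both ∷_) L) _ f)) ⟩
      ∑ (map (one ∷_) L) f + (∑ (map (both ∷_) L) f + ∑ (map (none ∷_) L) f)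
        ≡⟨ cong₂ _+_ (∑-map (one ∷_) L f) (cong₂ _+_ (∑-map (both ∷_) L f) (∑-map (none ∷_) L f)) ⟩
      part one b₁ b₂ + (part both b₁ b₂ + part none b₁ b₂) ∎
    exactly-one : ∀ b₁ b₂ → part one b₁ b₂ + (part both b₁ b₂ + part none b₁ b₂) ≡ c
    exactly-one true  true  = trans (cong₂ _+_ (∑-zero L) (cong₂ _+_ (∑-fits S B₁ B₂ c) (∑-zero L)))
                                    (trans (+-identityˡ _) (+-identityʳ c))
    exactly-one true  false = trans (cong₂ _+_ (∑-fits S B₁ B₂ c) (cong₂ _+_ (∑-zero L) (∑-zero L)))
                                    (trans (cong (c +_) (+-identityˡ 0#)) (+-identityʳ c))
    exactly-one false true  = trans (cong₂ _+_ (∑-fits S B₁ B₂ c) (cong₂ _+_ (∑-zero L) (∑-zero L)))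
                                    (trans (cong (c +_) (+-identityˡ 0#)) (+-identityʳ c))
    exactly-one false false = trans (cong₂ _+_ (∑-zero L) (cong₂ _+_ (∑-zero L) (∑-fits S B₁ B₂ c)))
                                    (trans (+-identityˡ _) (+-identityˡ c))

  ∧-guarded : ∀ a {b c} → (a ≡ true → b ≡ c) → a ∧ b ≡ a ∧ c
  ∧-guarded true  b≡c = b≡c refl
  ∧-guarded false _   = refl

  module _ {n} (M : Matroid n) where
    open PairSums F M
    open LabelledRays F M

    pairSum-by-labelling : ∀ S φ (y : Weights n) →
                           pairSum φ y ≡ ∑[ ℓ ← labellings S ] pairSum (λ B₁ B₂ → fits ℓ B₁ B₂ ∧ φ B₁ B₂) y
    pairSum-by-labelling S φ y = begin
      pairSum φ y
        ≡⟨ ∑-cong (bases M) (λ B₁ → ∑-cong (bases M) λ B₂ → sym (trans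
             (∑-cong (labellings S) λ ℓ → when-∧ (fits ℓ B₁ B₂) (φ B₁ B₂) _) (∑-fits S B₁ B₂ _))) ⟩
      ∑[ B₁ ← bases M ] ∑[ B₂ ← bases M ] ∑[ ℓ ← labellings S ] when (fits ℓ B₁ B₂ ∧ φ B₁ B₂) (mono y B₁ * mono y B₂)
        ≡⟨ trans (∑-cong (bases M) λ B₁ → ∑-comm (bases M) (labellings S) _) (∑-comm (bases M) (labellings S) _) ⟩
      ∑[ ℓ ← labellings S ] pairSum (λ B₁ B₂ → fits ℓ B₁ B₂ ∧ φ B₁ B₂) y ∎

    Mj-*-Mj : ∀ a b S (y : Weights n) →
              Mj M a S y * Mj M b S y ≡ pairSum (λ B₁ B₂ → (∣ B₁ ∩ S ∣ ≡ᵇ a) ∧ (∣ B₂ ∩ S ∣ ≡ᵇ b)) y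
    Mj-*-Mj a b S y =
      trans (cong₂ _*_ (selectSum≡∑ _ _ (bases M)) (selectSum≡∑ _ _ (bases M)))
        (trans (∑-*-∑ (bases M) (bases M) _ _) (∑-cong (bases M) λ B₁ → ∑-cong (bases M) λ B₂ →
          when-*-when (∣ B₁ ∩ S ∣ ≡ᵇ a) (∣ B₂ ∩ S ∣ ≡ᵇ b) _ _))

    module _ (m : ℕ) (λ′ : ℕ → R) (rays : ∀ k → 1 ≤ℕ k → k ≤ℕ m → Ray M k (λ′ k))
             (S : Subset n) (∣S∣≤2m+1 : ∣ S ∣ ≤ℕ suc (2 *ℕ m)) {y : Weights n} (y>0 : Positive y) (j′ : ℕ) where

      spread level : PairPredicate
      spread B₁ B₂ = (∣ B₁ ∩ S ∣ ≡ᵇ suc (suc j′)) ∧ (∣ B₂ ∩ S ∣ ≡ᵇ j′)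
      level  B₁ B₂ = (∣ B₁ ∩ S ∣ ≡ᵇ suc j′) ∧ (∣ B₂ ∩ S ∣ ≡ᵇ suc j′)

      spreadAt levelAt : Labelling n → PairPredicate
      spreadAt ℓ B₁ B₂ = fits ℓ B₁ B₂ ∧ spread B₁ B₂
      levelAt  ℓ B₁ B₂ = fits ℓ B₁ B₂ ∧ level B₁ B₂

      spreadSum levelSum : Labelling n → R
      spreadSum ℓ = pairSum (spreadAt ℓ) y
      levelSum  ℓ = pairSum (levelAt ℓ) y

      BelowRays : R → Set
      BelowRays c = ∀ k → 1 ≤ℕ k → k ≤ℕ suc j′ → k ≤ℕ ∣ S ∣ ∸ suc j′ → c ≤ λ′ k

      SpreadShape : Labelling n → Set
      SpreadShape ℓ = #both ℓ ≤ℕ j′ × ∣ ones ℓ ∣ ≡ suc (j′ ∸ #both ℓ) +ℕ suc (j′ ∸ #both ℓ)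

      module Counts {ℓ} (ℓ∈ : ℓ ∈ labellings S) where

        count₁ : ∀ {B₁ B₂} → fits ℓ B₁ B₂ ≡ true → ∣ B₁ ∩ S ∣ ≡ #both ℓ +ℕ ∣ ones ℓ ∩ B₁ ∣
        count₁ {B₁} {B₂} fit = subst (λ T → ∣ B₁ ∩ T ∣ ≡ _) (∈labellings⇒support S ℓ∈) (fits⇒∣B₁∩support∣ ℓ B₁ B₂ fit)

        count₂ : ∀ {B₁ B₂} → fits ℓ B₁ B₂ ≡ true → ∣ B₂ ∩ S ∣ ≡ #both ℓ +ℕ ∣ ones ℓ ∩ B₂ ∣
        count₂ {B₁} {B₂} fit = subst (λ T → ∣ B₂ ∩ T ∣ ≡ _) (∈labellings⇒support S ℓ∈) (fits⇒∣B₂∩support∣ ℓ B₁ B₂ fit)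

        ∣S∣≡ : ∣ S ∣ ≡ #both ℓ +ℕ #none ℓ +ℕ ∣ ones ℓ ∣
        ∣S∣≡ = subst (λ T → ∣ T ∣ ≡ _) (∈labellings⇒support S ℓ∈) (∣support∣ ℓ)

        ∣ones∣≤∣S∣ : ∣ ones ℓ ∣ ≤ℕ ∣ S ∣
        ∣ones∣≤∣S∣ = subst (∣ ones ℓ ∣ ≤ℕ_) (sym ∣S∣≡) (m≤n+m _ _)

        spread-shape : ∀ {B₁ B₂} → fits ℓ B₁ B₂ ≡ true → spread B₁ B₂ ≡ true → SpreadShape ℓ
        spread-shape {B₁} {B₂} fit spread≡true =
          spread-arithmetic (trans (sym (count₁ fit)) (≡ᵇ-true⇒≡ (∧-conicalˡ _ _ spread≡true)))
                           (trans (sym (count₂ fit)) (≡ᵇ-true⇒≡ (∧-conicalʳ _ _ spread≡true)))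
                           (fits⇒∣ones∩B₁∣+∣ones∩B₂∣ ℓ B₁ B₂ fit)

        spreadSum-vanishes : ¬ SpreadShape ℓ → spreadSum ℓ ≡ 0#
        spreadSum-vanishes ¬shape = pairSum-unsatisfiable λ B₁ B₂ fit∧spread →
          ¬shape (spread-shape (∧-conicalˡ _ _ fit∧spread) (∧-conicalʳ (fits ℓ B₁ B₂) _ fit∧spread))

        ¬shape⇒spreadSum≤levelSum : ∀ c → ¬ SpreadShape ℓ → c * spreadSum ℓ ≤ levelSum ℓ
        ¬shape⇒spreadSum≤levelSum c ¬shape =
          subst (_≤ levelSum ℓ) (sym (trans (cong (c *_) (spreadSum-vanishes ¬shape)) (zeroʳ c)))
            (pairSum-nonNeg y>0 (levelAt ℓ))

        module Balanced {k′} (a+k′≡j′ : #both ℓ +ℕ k′ ≡ j′) (∣ones∣≡ : ∣ ones ℓ ∣ ≡ suc k′ +ℕ suc k′) where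

          private
            a = #both ℓ

          spread≡ : ∀ B₁ B₂ → fits ℓ B₁ B₂ ≡ true → spread B₁ B₂ ≡ (∣ ones ℓ ∩ B₁ ∣ ≡ᵇ suc (suc k′))
          spread≡ B₁ B₂ fit = begin
            (∣ B₁ ∩ S ∣ ≡ᵇ suc (suc j′)) ∧ (∣ B₂ ∩ S ∣ ≡ᵇ j′)
              ≡⟨ cong₂ (λ u v → (u ≡ᵇ suc (suc j′)) ∧ (v ≡ᵇ j′)) (count₁ fit) (count₂ fit) ⟩
            (a +ℕ x₁ ≡ᵇ suc (suc j′)) ∧ (a +ℕ x₂ ≡ᵇ j′)
              ≡⟨ cong₂ (λ u v → (a +ℕ x₁ ≡ᵇ u) ∧ (a +ℕ x₂ ≡ᵇ v)) 2+j′≡ (sym a+k′≡j′) ⟩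
            (a +ℕ x₁ ≡ᵇ a +ℕ suc (suc k′)) ∧ (a +ℕ x₂ ≡ᵇ a +ℕ k′)
              ≡⟨ counts-≡ᵇ a (trans (fits⇒∣ones∩B₁∣+∣ones∩B₂∣ ℓ B₁ B₂ fit) (trans ∣ones∣≡ (cong suc (+-suc k′ k′)))) ⟩
            (x₁ ≡ᵇ suc (suc k′)) ∎
            where
            x₁ = ∣ ones ℓ ∩ B₁ ∣
            x₂ = ∣ ones ℓ ∩ B₂ ∣
            2+j′≡ : suc (suc j′) ≡ a +ℕ suc (suc k′)
            2+j′≡ = sym (trans (+-suc a (suc k′)) (cong suc (trans (+-suc a k′) (cong suc a+k′≡j′))))

          level≡ : ∀ B₁ B₂ → fits ℓ B₁ B₂ ≡ true → level B₁ B₂ ≡ (∣ ones ℓ ∩ B₁ ∣ ≡ᵇ suc k′)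
          level≡ B₁ B₂ fit = begin
            (∣ B₁ ∩ S ∣ ≡ᵇ suc j′) ∧ (∣ B₂ ∩ S ∣ ≡ᵇ suc j′)
              ≡⟨ cong₂ (λ u v → (u ≡ᵇ suc j′) ∧ (v ≡ᵇ suc j′)) (count₁ fit) (count₂ fit) ⟩
            (a +ℕ x₁ ≡ᵇ suc j′) ∧ (a +ℕ x₂ ≡ᵇ suc j′)
              ≡⟨ cong (λ u → (a +ℕ x₁ ≡ᵇ u) ∧ (a +ℕ x₂ ≡ᵇ u)) 1+j′≡ ⟩
            (a +ℕ x₁ ≡ᵇ a +ℕ suc k′) ∧ (a +ℕ x₂ ≡ᵇ a +ℕ suc k′)
              ≡⟨ counts-≡ᵇ a (trans (fits⇒∣ones∩B₁∣+∣ones∩B₂∣ ℓ B₁ B₂ fit) ∣ones∣≡) ⟩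
            (x₁ ≡ᵇ suc k′) ∎
            where
            x₁ = ∣ ones ℓ ∩ B₁ ∣
            x₂ = ∣ ones ℓ ∩ B₂ ∣
            1+j′≡ : suc j′ ≡ a +ℕ suc k′
            1+j′≡ = sym (trans (+-suc a k′) (cong suc a+k′≡j′))

          spreadSum≤levelSum : ∀ {c} → BelowRays c → c * spreadSum ℓ ≤ levelSum ℓ
          spreadSum≤levelSum {c} c≤λ′ =
            ≤-trans (*-monoˡ-≤-nonNeg (pairSum-nonNeg y>0 (spreadAt ℓ)) (c≤λ′ (suc k′) (s≤s z≤n) k≤1+j′ k≤∣S∣-1-j′))
              (subst₂ (λ u v → λ′ (suc k′) * u ≤ v) (sym spreadSum≡) (sym levelSum≡)
                (ray⇒labelledRay (rays (suc k′) (s≤s z≤n) k≤m) ℓ ∣ones∣≡ y y>0))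
            where
            spreadSum≡ : spreadSum ℓ ≡ labelledΨ ℓ (suc (suc k′)) y
            spreadSum≡ = pairSum-cong λ B₁ B₂ → ∧-guarded (fits ℓ B₁ B₂) (spread≡ B₁ B₂)
            levelSum≡ : levelSum ℓ ≡ labelledΨ ℓ (suc k′) y
            levelSum≡ = pairSum-cong λ B₁ B₂ → ∧-guarded (fits ℓ B₁ B₂) (level≡ B₁ B₂)
            k≤m : suc k′ ≤ℕ m
            k≤m = double≤odd⇒≤ (Nat.≤-trans (subst (_≤ℕ ∣ S ∣) ∣ones∣≡ ∣ones∣≤∣S∣) ∣S∣≤2m+1)
            k≤1+j′ : suc k′ ≤ℕ suc j′
            k≤1+j′ = subst (λ j → suc k′ ≤ℕ suc j) a+k′≡j′ (proj₁ (balanced-bounds a (#none ℓ) k′))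
            k≤∣S∣-1-j′ : suc k′ ≤ℕ ∣ S ∣ ∸ suc j′
            k≤∣S∣-1-j′ = subst₂ (λ s j → suc k′ ≤ℕ s ∸ suc j) (sym (trans ∣S∣≡ (cong (a +ℕ #none ℓ +ℕ_) ∣ones∣≡))) a+k′≡j′
                           (proj₂ (balanced-bounds a (#none ℓ) k′))

      spreadSum≤levelSum : ∀ {c} → BelowRays c → ∀ ℓ → ℓ ∈ labellings S → c * spreadSum ℓ ≤ levelSum ℓ
      spreadSum≤levelSum {c} c≤λ′ ℓ ℓ∈ with #both ℓ ≤? j′ | ∣ ones ℓ ∣ ≟ suc (j′ ∸ #both ℓ) +ℕ suc (j′ ∸ #both ℓ)
      ... | yes a≤j′ | yes ∣ones∣≡ = Counts.Balanced.spreadSum≤levelSum ℓ∈ (m+[n∸m]≡n a≤j′) ∣ones∣≡ c≤λ′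
      ... | yes _    | no ∣ones∣≢  = Counts.¬shape⇒spreadSum≤levelSum ℓ∈ c λ (_ , ∣ones∣≡) → ∣ones∣≢ ∣ones∣≡
      ... | no a≰j′  | _           = Counts.¬shape⇒spreadSum≤levelSum ℓ∈ c λ (a≤j′ , _) → a≰j′ a≤j′

      diagonal-strict : ∀ c {B} → B ∈ bases M → (∣ B ∩ S ∣ ≡ᵇ suc j′) ≡ true →
                        c * spreadSum (diagonal S B) < levelSum (diagonal S B)
      diagonal-strict c {B} B∈ B-level =
        subst (_< levelSum (diagonal S B)) (sym (trans (cong (c *_) vanishes) (zeroʳ c)))
          (pairSum-pos y>0 (levelAt (diagonal S B)) B∈ B∈ fits∧level)
        where
        fits∧level : levelAt (diagonal S B) B B ≡ true
        fits∧level = subst₂ (λ u v → u ∧ (v ∧ v) ≡ true) (sym (fits-diagonal S B)) (sym B-level) refl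
        vanishes : spreadSum (diagonal S B) ≡ 0#
        vanishes = Counts.spreadSum-vanishes (diagonal∈labellings S B) λ (_ , ∣ones∣≡) →
          0≢1+n (trans (sym (∣ones-diagonal∣ S B)) ∣ones∣≡)

      ray⇒strictly-log-concave : ∀ {c} → BelowRays c → ¬ (Mj M (suc j′) S y ≡ 0#) →
        c * (Mj M j′ S y * Mj M (suc (suc j′)) S y) < Mj M (suc j′) S y * Mj M (suc j′) S y
      ray⇒strictly-log-concave {c} c≤λ′ Mj≢0
        with ∑-when≢0⇒∃ (bases M) (λ B → ∣ B ∩ S ∣ ≡ᵇ suc j′) (mono y) (λ ∑≡0 → Mj≢0 (trans (selectSum≡∑ _ _ (bases M)) ∑≡0))
      ... | B , B∈ , B-level = subst₂ _<_ (sym lhs) (sym rhs)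
            (∑-mono-< (labellings S) (spreadSum≤levelSum c≤λ′) (diagonal∈labellings S B) (diagonal-strict c B∈ B-level))
        where
        lhs : c * (Mj M j′ S y * Mj M (suc (suc j′)) S y) ≡ ∑[ ℓ ← labellings S ] (c * spreadSum ℓ)
        lhs = begin
          c * (Mj M j′ S y * Mj M (suc (suc j′)) S y)  ≡⟨ cong (c *_) (*-comm _ _) ⟩
          c * (Mj M (suc (suc j′)) S y * Mj M j′ S y)  ≡⟨ cong (c *_) (Mj-*-Mj (suc (suc j′)) j′ S y) ⟩
          c * pairSum spread y                          ≡⟨ cong (c *_) (pairSum-by-labelling S spread y) ⟩
          c * ∑[ ℓ ← labellings S ] spreadSum ℓ         ≡⟨ *-distribˡ-∑ c (labellings S) spreadSum ⟩
          ∑[ ℓ ← labellings S ] (c * spreadSum ℓ)       ∎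
        rhs : Mj M (suc j′) S y * Mj M (suc j′) S y ≡ ∑[ ℓ ← labellings S ] levelSum ℓ
        rhs = trans (Mj-*-Mj (suc j′) (suc j′) S y) (pairSum-by-labelling S level y)

module Theorem (F : CompleteOrderedField) {n} (M : Matroid n) (m : ℕ) where
  open CompleteOrderedField F
  open OrderedFieldProperties F
  open RayToLogConcavity F
  open Theory F using (fromℕ; Mj; Ray; SqrtBLC; SLC)
  open import Data.Fin.Subset using (∣_∣)
  open import Data.Nat using (suc; _∸_; _⊓_) renaming (_*_ to _*ℕ_; _≤_ to _≤ℕ_)
  open import Data.Nat.Properties using (⊓-glb)
  open import Relation.Binary.PropositionalEquality using (subst)

  ray⇒sqrtBLC : (∀ k → 1 ≤ℕ k → k ≤ℕ m → Ray M k (1# + inv (fromℕ k))) → SqrtBLC M (suc (2 *ℕ m))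
  ray⇒sqrtBLC rays y y>0 S ∣S∣≤2m+1 (suc j′) _ _ =
    ray⇒strictly-log-concave M m (λ k → 1# + inv (fromℕ k)) rays S ∣S∣≤2m+1 y>0 j′ below
    where
    below : ∀ k → 1 ≤ℕ k → k ≤ℕ suc j′ → k ≤ℕ ∣ S ∣ ∸ suc j′ →
            1# + inv (fromℕ (suc j′ ⊓ (∣ S ∣ ∸ suc j′))) ≤ 1# + inv (fromℕ k)
    below (suc k′) _ k≤j k≤∣S∣-j = +-monoʳ-≤ 1# (inv-antitone (fromℕ-pos k′) (fromℕ-mono (⊓-glb k≤j k≤∣S∣-j)))

  ray⇒SLC : (∀ k → 1 ≤ℕ k → k ≤ℕ m → Ray M k 1#) → SLC M (suc (2 *ℕ m))
  ray⇒SLC rays y y>0 S ∣S∣≤2m+1 (suc j′) _ _ Mj≢0 =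
    subst (_< Mj M (suc j′) S y * Mj M (suc j′) S y) (*-identityˡ _)
      (ray⇒strictly-log-concave M m (λ _ → 1#) rays S ∣S∣≤2m+1 y>0 j′ (λ _ _ _ _ → ≤-refl) Mj≢0)

open import Data.Nat using (ℕ; suc; _≤_; _+_; _*_)
open import Data.Product using (_×_; _,_)

mainTheorem4 : (F : CompleteOrderedField) → (m : ℕ) → 1 ≤ m → ∀ {n} → (M : Matroid n) →
    (((k : ℕ) → 1 ≤ k → k ≤ m →
        Theory.Ray F M k (CompleteOrderedField._+_ F (CompleteOrderedField.1# F)
          (CompleteOrderedField.inv F (Theory.fromℕ F k))))
      → Theory.SqrtBLC F M (suc (2 * m)))
  × (((k : ℕ) → 1 ≤ k → k ≤ m → Theory.Ray F M k (CompleteOrderedField.1# F))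
      → Theory.SLC F M (suc (2 * m)))
mainTheorem4 F m _ M = Theorem.ray⇒sqrtBLC F M m , Theorem.ray⇒SLC F M m
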